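{- Let $G$ be a simple graph and let $n,m$ be integers with $0<m<n$. If $G$ has a fractional $[1,\frac{n}{m}]$-factor, then $G$ has a fractional $[1,\frac{n}{m}]$-factor with values in $\{0,\frac{1}{m},\dots,\frac{m-1}{m},1\}$.
   Context: For a graph $G$, $h:E(G)\to[0,1]$ and $v\in V(G)$ let $d^h(v)=\sum_{e \ni v} h(e)$ (sum over edges incident with $v$). A fractional $[a,b]$-factor of $G$ is a function $h:E(G)\to[0,1]$ with $a\le d^h(v)\le b$ for all $v\in V(G)$.
   Formalization: The fractional $[1,\frac{n}{m}]$-factor assumed in the hypothesis takes only rational values in $[0,1]$. -}

module Defs where

open import Data.Bool using (Bool; true; false; if_then_else_)
open import Data.Nat as ℕ using (ℕ; _<_)
open import Data.Fin using (Fin)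
open import Data.List using (List; map; foldr)
open import Data.List using () renaming (allFin to allFinL)
open import Data.Integer using (+_)
open import Data.Rational using (ℚ; 0ℚ; 1ℚ; _+_; _≤_; _/_)
open import Data.Product using (Σ; ∃; _×_)
open import Relation.Binary.PropositionalEquality using (_≡_)
open import Relation.Nullary using (¬_)

record SimpleGraph (N : ℕ) : Set where
  field
    adj    : Fin N → Fin N → Bool
    sym    : ∀ u v → adj u v ≡ adj v u
    irrefl : ∀ v → adj v v ≡ false
open SimpleGraph public

-- A function h : E(G) → ℚ is represented by a weight W on ordered pairs,
-- required to be symmetric on edges (so it is a function of the unordered
-- edge {u,v}); its values on non-edges are irrelevant.
Weight : ℕ → Set
Weight N = Fin N → Fin N → ℚ

sumℚ : List ℚ → ℚ
sumℚ = foldr _+_ 0ℚ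

degree : ∀ {N} → SimpleGraph N → Weight N → Fin N → ℚ
degree G W v = sumℚ (map (λ u → if adj G v u then W v u else 0ℚ) (allFinL _))

IsEdgeFunction : ∀ {N} → SimpleGraph N → Weight N → Set
IsEdgeFunction G W = ∀ u v → adj G u v ≡ true → W u v ≡ W v u

IsFractionalFactor : ∀ {N} → SimpleGraph N → ℚ → ℚ → Weight N → Set
IsFractionalFactor G a b W =
  IsEdgeFunction G W
  × (∀ u v → adj G u v ≡ true → (0ℚ ≤ W u v) × (W u v ≤ 1ℚ))
  × (∀ v → (a ≤ degree G W v) × (degree G W v ≤ b))

frac : (k m : ℕ) → 0 < m → ℚ
frac k m 0<m = ((+ k) / m) {{ℕ.>-nonZero 0<m}}

ValuesIn1/m : ∀ {N} → SimpleGraph N → (m : ℕ) → 0 < m → Weight N → Set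
ValuesIn1/m G m 0<m W =
  ∀ u v → adj G u v ≡ true → ∃ λ k → (k ℕ.≤ m) × (W u v ≡ frac k m 0<m)

-- Clearing denominators turns m·h into x / D for a symmetric integral matrix x with entries in
-- [0, D m] and row sums in [D m, D n]; it suffices to round x to an integral matrix with entries in
-- [0, m] and row sums in [m, n], and to divide that by m.  A rounding step adds +1, -1, +1, …
-- along a path of fractional entries (those not divisible by D) joining two vertices of fractional
-- degree, or around a cycle of fractional entries: all degrees stay in range, and for one of the two
-- choices of sign the potential Σ (x mod D)(D - x mod D) strictly decreases.  An odd cycle through a
-- vertex of integral degree would move that degree by ±2.  Hence one first rounds on the bipartite
-- double cover, where all cycles are even, and adds the two copies of each edge, which leaves a
-- half-integral solution (D = 2) with row sums in [2m, 2n].  Rounding that, both signs lower the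
-- potential of an odd cycle, and as m < n one of them keeps the degree of its base vertex in range.

module Submission where

open import Defs hiding (sym)
open import Data.Nat using (ℕ; _<_; suc; z<s; >-nonZero)
open import Data.Product using (∃; _×_; _,_)
open import Data.Rational using (1ℚ)

module FiniteSums where

  open import Data.Nat as ℕ using (ℕ; zero; suc; z≤n)
  import Data.Nat.Properties as ℕP
  open import Data.Nat.DivMod using (_%_; %-distribˡ-+; m%n%n≡m%n)
  open import Data.Integer as ℤ using (ℤ; +_)
  import Data.Integer.Properties as ℤP
  open import Data.Fin using (Fin; zero; suc; _↑ˡ_; _↑ʳ_)
  open import Data.Fin.Properties using (suc-injective)
  open import Function using (_∘_)
  open import Relation.Binary.PropositionalEquality

  import Algebra.Properties.Semiring.Sum as SemiringSum
  module ℕ∑ = SemiringSum ℕP.+-*-semiring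
  module ℤ∑ = SemiringSum ℤP.+-*-semiring
  open ℕ∑ using (sum; sum-cong-≗; ∑-distrib-+; *-distribˡ-sum; *-distribʳ-sum) public
  open ℤ∑ using () renaming (sum to sumℤ) public

  sum-zero : ∀ {K} (f : Fin K → ℕ) → (∀ i → f i ≡ 0) → sum f ≡ 0
  sum-zero {K} f f≡0 = trans (sum-cong-≗ f≡0) (ℕ∑.sum-replicate-zero K)

  sumℤ-zero : ∀ {K} (f : Fin K → ℤ) → (∀ i → f i ≡ + 0) → sumℤ f ≡ + 0
  sumℤ-zero {K} f f≡0 = trans (ℤ∑.sum-cong-≗ f≡0) (ℤ∑.sum-replicate-zero K)

  sum-const-1 : ∀ K → sum {K} (λ _ → 1) ≡ K
  sum-const-1 zero = refl
  sum-const-1 (suc K) = cong suc (sum-const-1 K)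

  pos-sum : ∀ {K} (f : Fin K → ℕ) → + sum f ≡ sumℤ (+_ ∘ f)
  pos-sum {zero} f = refl
  pos-sum {suc K} f = trans (ℤP.pos-+ (f zero) _) (cong (ℤ._+_ (+ f zero)) (pos-sum (f ∘ suc)))

  sum-single : ∀ {K} (f : Fin K → ℕ) (w : Fin K) → (∀ i → i ≢ w → f i ≡ 0) → sum f ≡ f w
  sum-single {suc K} f zero f≡0 =
    trans (cong (f zero ℕ.+_) (sum-zero (f ∘ suc) (λ i → f≡0 (suc i) (λ ())))) (ℕP.+-identityʳ _)
  sum-single {suc K} f (suc w) f≡0 rewrite f≡0 zero (λ ()) =
    sum-single (f ∘ suc) w (λ i i≢w → f≡0 (suc i) (i≢w ∘ suc-injective))

  ≤-sum : ∀ {K} (f : Fin K → ℕ) (w : Fin K) → f w ℕ.≤ sum f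
  ≤-sum {suc K} f zero = ℕP.m≤m+n _ _
  ≤-sum {suc K} f (suc w) = ℕP.≤-trans (≤-sum (f ∘ suc) w) (ℕP.m≤n+m _ _)

  sum-mono-≤ : ∀ {K} {f g : Fin K → ℕ} → (∀ i → f i ℕ.≤ g i) → sum f ℕ.≤ sum g
  sum-mono-≤ {zero} f≤g = z≤n
  sum-mono-≤ {suc K} f≤g = ℕP.+-mono-≤ (f≤g zero) (sum-mono-≤ (f≤g ∘ suc))

  sum-↑ : ∀ A B (f : Fin (A ℕ.+ B) → ℕ) → sum f ≡ sum (λ i → f (i ↑ˡ B)) ℕ.+ sum (λ i → f (A ↑ʳ i))
  sum-↑ zero B f = refl
  sum-↑ (suc A) B f = trans (cong (f zero ℕ.+_) (sum-↑ A B (f ∘ suc))) (sym (ℕP.+-assoc (f zero) _ _))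

  sum-% : ∀ {K} (D : ℕ) .{{_ : ℕ.NonZero D}} (f : Fin K → ℕ) → sum f % D ≡ sum (λ i → f i % D) % D
  sum-% {zero} D f = refl
  sum-% {suc K} D f = begin
    (f zero ℕ.+ sum (f ∘ suc)) % D
      ≡⟨ %-distribˡ-+ (f zero) _ D ⟩
    (f zero % D ℕ.+ sum (f ∘ suc) % D) % D
      ≡⟨ cong (λ s → (f zero % D ℕ.+ s) % D) (sum-% D (f ∘ suc)) ⟩
    (f zero % D ℕ.+ rest % D) % D
      ≡⟨ cong (λ s → (s ℕ.+ rest % D) % D) (m%n%n≡m%n (f zero) D) ⟨
    (f zero % D % D ℕ.+ rest % D) % D
      ≡⟨ %-distribˡ-+ (f zero % D) rest D ⟨
    (f zero % D ℕ.+ rest) % D ∎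
    where
    open ≡-Reasoning
    rest : ℕ
    rest = sum (λ i → f (suc i) % D)

open FiniteSums

module AlternatingWalks where

  open import Data.Nat as ℕ using (ℕ)
  open import Data.Integer using (ℤ; 0ℤ; 1ℤ; -1ℤ; _+_; _*_; -_)
  import Data.Integer.Properties as ℤP
  open import Data.Integer.Tactic.RingSolver using (solve-∀)
  open import Data.Fin using (Fin; zero; suc)
  open import Data.Fin.Properties using (_≟_)
  open import Data.Bool using (Bool; true; false; not; _xor_; if_then_else_)
  open import Data.Bool.Properties using (not-distribˡ-xor; not-distribʳ-xor)
  open import Data.List using (List; []; _∷_; _++_; [_])
  open import Data.List.Membership.Propositional using (_∈_; _∉_)
  open import Data.List.Relation.Unary.Any using (here; there)
  import Data.List.Relation.Unary.All.Properties as All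
  open All using (All¬⇒¬Any)
  open import Data.List.Relation.Unary.Unique.Propositional using (Unique)
  open import Data.List.Relation.Unary.AllPairs using ([]; _∷_)
  open import Data.List.Relation.Unary.Linked using (Linked; []; [-]; _∷_)
  open import Data.Product using (_×_; _,_; proj₁; proj₂; Σ-syntax)
  open import Data.Sum using (_⊎_; inj₁; inj₂)
  open import Function using (_∘_)
  open import Relation.Nullary using (¬_; yes; no; does; contradiction; _×-dec_)
  open import Relation.Binary.PropositionalEquality hiding ([_])

  sign : Bool → ℤ
  sign true = 1ℤ
  sign false = -1ℤ

  sign-not : ∀ b → sign (not b) ≡ - sign b
  sign-not true = refl
  sign-not false = refl

  UnitOrZero : ℤ → Set
  UnitOrZero z = z ≡ 0ℤ ⊎ Σ[ b ∈ Bool ] z ≡ sign b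

  unique-head : ∀ {A : Set} {x : A} {xs} → Unique (x ∷ xs) → x ∉ xs
  unique-head (x≢xs ∷ _) = All¬⇒¬Any x≢xs

  Unique-prefix : ∀ {A : Set} (xs : List A) {ys} → Unique (xs ++ ys) → Unique xs
  Unique-prefix [] _ = []
  Unique-prefix (x ∷ xs) (x∉ ∷ u) = All.++⁻ˡ xs x∉ ∷ Unique-prefix xs u

  Linked-prefix : ∀ {A : Set} {R : A → A → Set} (xs : List A) {ys} → Linked R (xs ++ ys) → Linked R xs
  Linked-prefix [] _ = []
  Linked-prefix (x ∷ []) _ = [-]
  Linked-prefix (x ∷ x' ∷ xs) (r ∷ l) = r ∷ Linked-prefix (x' ∷ xs) l

  private variable K : ℕ

  opaque
    δ : Fin K → Fin K → ℤ
    δ x w = if does (x ≟ w) then 1ℤ else 0ℤ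

    δ-refl : (x : Fin K) → δ x x ≡ 1ℤ
    δ-refl x with x ≟ x
    ... | yes _ = refl
    ... | no x≢x = contradiction refl x≢x

    δ-≢ : {x w : Fin K} → x ≢ w → δ x w ≡ 0ℤ
    δ-≢ {x = x} {w} x≢w with x ≟ w
    ... | yes x≡w = contradiction x≡w x≢w
    ... | no _ = refl

    ∑-δ : (w : Fin K) → sumℤ (λ y → δ y w) ≡ 1ℤ
    ∑-δ {ℕ.suc K} zero = cong (1ℤ +_) (sumℤ-zero {K} (λ i → δ (suc i) zero) (λ i → refl))
    ∑-δ (suc w) = trans (ℤP.+-identityˡ _) (∑-δ w)

  δ-01 : (x w : Fin K) → δ x w ≡ 0ℤ ⊎ δ x w ≡ 1ℤ
  δ-01 x w with x ≟ w
  ... | yes refl = inj₂ (δ-refl x)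
  ... | no x≢w = inj₁ (δ-≢ x≢w)

  δδ-≡0 : {x w y w' : Fin K} → ¬ (x ≡ w × y ≡ w') → δ x w * δ y w' ≡ 0ℤ
  δδ-≡0 {x = x} {w} {y} {w'} ¬xy with x ≟ w
  ... | no x≢w = trans (cong (_* δ y w') (δ-≢ x≢w)) (ℤP.*-zeroˡ (δ y w'))
  ... | yes x≡w = trans (cong (δ x w *_) (δ-≢ (λ y≡w' → ¬xy (x≡w , y≡w')))) (ℤP.*-zeroʳ (δ x w))

  edgeδ : Fin K → Fin K → Fin K → Fin K → ℤ
  edgeδ w w' x y = δ x w * δ y w' + δ x w' * δ y w

  edgeδ-sym : (w w' x y : Fin K) → edgeδ w w' x y ≡ edgeδ w w' y x
  edgeδ-sym w w' x y = swap (δ x w) (δ y w') (δ x w') (δ y w)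
    where
    swap : ∀ a b c d → a * b + c * d ≡ d * c + b * a
    swap = solve-∀

  ∑-edgeδ : (w w' x : Fin K) → sumℤ (edgeδ w w' x) ≡ δ x w + δ x w'
  ∑-edgeδ w w' x = begin
    sumℤ (edgeδ w w' x)
      ≡⟨ ℤ∑.∑-distrib-+ (λ y → δ x w * δ y w') (λ y → δ x w' * δ y w) ⟩
    sumℤ (λ y → δ x w * δ y w') + sumℤ (λ y → δ x w' * δ y w)
      ≡⟨ cong₂ _+_ (ℤ∑.*-distribˡ-sum (δ x w) (λ y → δ y w')) (ℤ∑.*-distribˡ-sum (δ x w') (λ y → δ y w)) ⟨
    δ x w * sumℤ (λ y → δ y w') + δ x w' * sumℤ (λ y → δ y w)
      ≡⟨ cong₂ (λ s t → δ x w * s + δ x w' * t) (∑-δ w') (∑-δ w) ⟩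
    δ x w * 1ℤ + δ x w' * 1ℤ
      ≡⟨ cong₂ _+_ (ℤP.*-identityʳ (δ x w)) (ℤP.*-identityʳ (δ x w')) ⟩
    δ x w + δ x w' ∎
    where open ≡-Reasoning

  edgeδ-≡0 : {w w' x y : Fin K} → ¬ (x ≡ w × y ≡ w') → ¬ (x ≡ w' × y ≡ w) → edgeδ w w' x y ≡ 0ℤ
  edgeδ-≡0 ¬xy ¬yx = cong₂ _+_ (δδ-≡0 ¬xy) (δδ-≡0 ¬yx)

  edgeδ-∉ : {w w' x y : Fin K} → x ≢ w → x ≢ w' → edgeδ w w' x y ≡ 0ℤ
  edgeδ-∉ x≢w x≢w' = edgeδ-≡0 (x≢w ∘ proj₁) (x≢w' ∘ proj₁)

  edgeδ-≡1 : {w w' : Fin K} → w ≢ w' → edgeδ w w' w w' ≡ 1ℤ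
  edgeδ-≡1 {w = w} {w'} w≢w' =
    cong₂ _+_ (cong₂ _*_ (δ-refl w) (δ-refl w')) (δδ-≡0 {x = w} {w'} {w'} {w} (w≢w' ∘ proj₁))

  edgeδ-head : {w w' : Fin K} → w ≢ w' → (y : Fin K) → edgeδ w w' w y ≡ δ y w'
  edgeδ-head {w = w} {w'} w≢w' y = begin
    δ w w * δ y w' + δ w w' * δ y w ≡⟨ cong₂ _+_ (cong (_* δ y w') (δ-refl w)) (δδ-≡0 {x = w} {w'} {y} {w} (w≢w' ∘ proj₁)) ⟩
    1ℤ * δ y w' + 0ℤ              ≡⟨ ℤP.+-identityʳ (1ℤ * δ y w') ⟩
    1ℤ * δ y w'                   ≡⟨ ℤP.*-identityˡ (δ y w') ⟩
    δ y w'                        ∎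
    where open ≡-Reasoning

  alternating : List (Fin K) → Bool → Fin K → Fin K → ℤ
  alternating (w ∷ w' ∷ ws) b x y = sign b * edgeδ w w' x y + alternating (w' ∷ ws) (not b) x y
  alternating _ _ _ _ = 0ℤ

  -- the sign that alternating (w ∷ ws) b gives to the last edge of the walk
  finalSign : List (Fin K) → Bool → Bool
  finalSign (w' ∷ w'' ∷ ws) b = finalSign (w'' ∷ ws) (not b)
  finalSign _ b = b

  lastOf : Fin K → List (Fin K) → Fin K
  lastOf w [] = w
  lastOf w (w' ∷ ws) = lastOf w' ws

  finalSign-not : (ws : List (Fin K)) (b : Bool) → finalSign ws (not b) ≡ not (finalSign ws b)
  finalSign-not [] b = refl
  finalSign-not (w' ∷ []) b = refl
  finalSign-not (w' ∷ w'' ∷ ws) b = finalSign-not (w'' ∷ ws) (not b)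

  alternating-sym : (L : List (Fin K)) (b : Bool) (x y : Fin K) → alternating L b x y ≡ alternating L b y x
  alternating-sym [] b x y = refl
  alternating-sym (w ∷ []) b x y = refl
  alternating-sym (w ∷ w' ∷ ws) b x y =
    cong₂ _+_ (cong (sign b *_) (edgeδ-sym w w' x y)) (alternating-sym (w' ∷ ws) (not b) x y)

  alternating-not : (L : List (Fin K)) (b : Bool) (x y : Fin K) → alternating L (not b) x y ≡ - alternating L b x y
  alternating-not [] b x y = refl
  alternating-not (w ∷ []) b x y = refl
  alternating-not (w ∷ w' ∷ ws) b x y = begin
    sign (not b) * e + alternating (w' ∷ ws) (not (not b)) x y
      ≡⟨ cong₂ (λ s r → s * e + r) (sign-not b) (alternating-not (w' ∷ ws) (not b) x y) ⟩
    - sign b * e + - alternating (w' ∷ ws) (not b) x y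
      ≡⟨ neg-out (sign b) e _ ⟩
    - (sign b * e + alternating (w' ∷ ws) (not b) x y) ∎
    where
    open ≡-Reasoning
    e : ℤ
    e = edgeδ w w' x y
    neg-out : ∀ s e r → - s * e + - r ≡ - (s * e + r)
    neg-out = solve-∀

  alternating-cons-≡ : (w w' : Fin K) (ws : List (Fin K)) (b : Bool) {x y : Fin K} → edgeδ w w' x y ≡ 0ℤ →
                       alternating (w ∷ w' ∷ ws) b x y ≡ alternating (w' ∷ ws) (not b) x y
  alternating-cons-≡ w w' ws b {x} {y} e≡0 = begin
    sign b * edgeδ w w' x y + r ≡⟨ cong (λ e → sign b * e + r) e≡0 ⟩
    sign b * 0ℤ + r             ≡⟨ cong (_+ r) (ℤP.*-zeroʳ (sign b)) ⟩
    0ℤ + r                      ≡⟨ ℤP.+-identityˡ r ⟩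
    r                           ∎
    where
    open ≡-Reasoning
    r : ℤ
    r = alternating (w' ∷ ws) (not b) x y

  alternating-∉ : (L : List (Fin K)) (b : Bool) {x : Fin K} (y : Fin K) → x ∉ L → alternating L b x y ≡ 0ℤ
  alternating-∉ [] b y x∉L = refl
  alternating-∉ (w ∷ []) b y x∉L = refl
  alternating-∉ (w ∷ w' ∷ ws) b y x∉L =
    trans (alternating-cons-≡ w w' ws b (edgeδ-∉ (x∉L ∘ here) (x∉L ∘ there ∘ here)))
          (alternating-∉ (w' ∷ ws) (not b) y (x∉L ∘ there))

  alternating-∉ʳ : (L : List (Fin K)) (b : Bool) (x : Fin K) {y : Fin K} → y ∉ L → alternating L b x y ≡ 0ℤ
  alternating-∉ʳ L b x {y} y∉L = trans (alternating-sym L b x y) (alternating-∉ L b x y∉L)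

  sign*-unitOrZero : (b : Bool) {z : ℤ} → z ≡ 0ℤ ⊎ z ≡ 1ℤ → UnitOrZero (sign b * z)
  sign*-unitOrZero b (inj₁ refl) = inj₁ (ℤP.*-zeroʳ (sign b))
  sign*-unitOrZero b (inj₂ refl) = inj₂ (b , ℤP.*-identityʳ (sign b))

  alternating-from-head : (w w' : Fin K) (ws : List (Fin K)) (b : Bool) (y : Fin K) → w ∉ w' ∷ ws →
                          alternating (w ∷ w' ∷ ws) b w y ≡ sign b * δ y w'
  alternating-from-head w w' ws b y w∉ = begin
    sign b * edgeδ w w' w y + alternating (w' ∷ ws) (not b) w y
      ≡⟨ cong₂ (λ e r → sign b * e + r) (edgeδ-head (w∉ ∘ here) y) (alternating-∉ (w' ∷ ws) (not b) y w∉) ⟩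
    sign b * δ y w' + 0ℤ
      ≡⟨ ℤP.+-identityʳ _ ⟩
    sign b * δ y w' ∎
    where open ≡-Reasoning

  alternating-unitOrZero : (L : List (Fin K)) (b : Bool) (x y : Fin K) → Unique L → UnitOrZero (alternating L b x y)
  alternating-unitOrZero [] b x y _ = inj₁ refl
  alternating-unitOrZero (w ∷ []) b x y _ = inj₁ refl
  alternating-unitOrZero (w ∷ w' ∷ ws) b x y u@(_ ∷ u') with x ≟ w | y ≟ w
  ... | yes refl | _ =
    subst UnitOrZero (sym (alternating-from-head w w' ws b y (unique-head u))) (sign*-unitOrZero b (δ-01 y w'))
  ... | no _ | yes refl =
    subst UnitOrZero (sym (trans (alternating-sym (w ∷ w' ∷ ws) b x w) (alternating-from-head w w' ws b x (unique-head u))))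
          (sign*-unitOrZero b (δ-01 x w'))
  ... | no x≢w | no y≢w = subst UnitOrZero (sym (alternating-cons-≡ w w' ws b (edgeδ-≡0 (x≢w ∘ proj₁) (y≢w ∘ proj₂))))
                            (alternating-unitOrZero (w' ∷ ws) (not b) x y u')

  alternating-support : {R : Fin K → Fin K → Set} → (∀ {x y} → R x y → R y x) →
                        (L : List (Fin K)) (b : Bool) (x y : Fin K) → Linked R L → alternating L b x y ≢ 0ℤ → R x y
  alternating-support R-sym [] b x y _ ≢0 = contradiction refl ≢0
  alternating-support R-sym (w ∷ []) b x y _ ≢0 = contradiction refl ≢0
  alternating-support R-sym (w ∷ w' ∷ ws) b x y (Rww' ∷ linked) ≢0 with (x ≟ w ×-dec y ≟ w') | (x ≟ w' ×-dec y ≟ w)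
  ... | yes (refl , refl) | _ = Rww'
  ... | no _ | yes (refl , refl) = R-sym Rww'
  ... | no ¬xy | no ¬yx = alternating-support R-sym (w' ∷ ws) (not b) x y linked
                            (≢0 ∘ trans (alternating-cons-≡ w w' ws b (edgeδ-≡0 ¬xy ¬yx)))

  ∑-alternating : (w w' : Fin K) (ws : List (Fin K)) (b : Bool) (x : Fin K) →
                  sumℤ (alternating (w ∷ w' ∷ ws) b x) ≡ sign b * δ x w + sign (finalSign (w' ∷ ws) b) * δ x (lastOf w' ws)
  ∑-alternating {K = K} w w' ws b x = begin
    sumℤ (alternating (w ∷ w' ∷ ws) b x)
      ≡⟨ ℤ∑.∑-distrib-+ (λ y → sign b * edgeδ w w' x y) (alternating (w' ∷ ws) (not b) x) ⟩
    sumℤ (λ y → sign b * edgeδ w w' x y) + sumℤ (alternating (w' ∷ ws) (not b) x)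
      ≡⟨ cong (_+ sumℤ (alternating (w' ∷ ws) (not b) x)) (ℤ∑.*-distribˡ-sum (sign b) (edgeδ w w' x)) ⟨
    sign b * sumℤ (edgeδ w w' x) + sumℤ (alternating (w' ∷ ws) (not b) x)
      ≡⟨ cong (λ s → sign b * s + sumℤ (alternating (w' ∷ ws) (not b) x)) (∑-edgeδ w w' x) ⟩
    sign b * (δ x w + δ x w') + sumℤ (alternating (w' ∷ ws) (not b) x)
      ≡⟨ tail-sum ws ⟩
    sign b * δ x w + sign (finalSign (w' ∷ ws) b) * δ x (lastOf w' ws) ∎
    where
    open ≡-Reasoning
    tail-sum : ∀ ws → sign b * (δ x w + δ x w') + sumℤ (alternating (w' ∷ ws) (not b) x) ≡
                      sign b * δ x w + sign (finalSign (w' ∷ ws) b) * δ x (lastOf w' ws)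
    tail-sum [] = trans (cong (sign b * (δ x w + δ x w') +_) (sumℤ-zero (λ (_ : Fin K) → 0ℤ) (λ _ → refl)))
                        (trans (ℤP.+-identityʳ _) (ℤP.*-distribˡ-+ (sign b) (δ x w) (δ x w')))
    tail-sum (w'' ∷ ws) = begin
      sign b * (δ x w + δ x w') + sumℤ (alternating (w' ∷ w'' ∷ ws) (not b) x)
        ≡⟨ cong (sign b * (δ x w + δ x w') +_) (∑-alternating w' w'' ws (not b) x) ⟩
      sign b * (δ x w + δ x w') + (sign (not b) * δ x w' + t)
        ≡⟨ cong (λ s → sign b * (δ x w + δ x w') + (s * δ x w' + t)) (sign-not b) ⟩
      sign b * (δ x w + δ x w') + (- sign b * δ x w' + t)
        ≡⟨ cancel (sign b) (δ x w) (δ x w') t ⟩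
      sign b * δ x w + t ∎
      where
      t : ℤ
      t = sign (finalSign (w'' ∷ ws) (not b)) * δ x (lastOf w'' ws)
      cancel : ∀ s a a' t → s * (a + a') + (- s * a' + t) ≡ s * a + t
      cancel = solve-∀

  alternating-head : (w w' : Fin K) (ws : List (Fin K)) (b : Bool) → w ∉ w' ∷ ws → alternating (w ∷ w' ∷ ws) b w w' ≡ sign b
  alternating-head w w' ws b w∉ =
    trans (alternating-from-head w w' ws b w' w∉) (trans (cong (sign b *_) (δ-refl w')) (ℤP.*-identityʳ (sign b)))

  module _ (w w' : Fin K) (ws : List (Fin K)) (b : Bool) where

    private
      s : ℤ
      s = sign (finalSign (w' ∷ ws) b)

    ∑-alternating-start : lastOf w' ws ≢ w → sumℤ (alternating (w ∷ w' ∷ ws) b w) ≡ sign b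
    ∑-alternating-start end≢w = begin
      sumℤ (alternating (w ∷ w' ∷ ws) b w)         ≡⟨ ∑-alternating w w' ws b w ⟩
      sign b * δ w w + s * δ w (lastOf w' ws)      ≡⟨ cong₂ (λ p q → sign b * p + s * q) (δ-refl w) (δ-≢ (end≢w ∘ sym)) ⟩
      sign b * 1ℤ + s * 0ℤ                         ≡⟨ only-first (sign b) s ⟩
      sign b                                       ∎
      where
      open ≡-Reasoning
      only-first : ∀ p q → p * 1ℤ + q * 0ℤ ≡ p
      only-first = solve-∀

    ∑-alternating-end : lastOf w' ws ≢ w → sumℤ (alternating (w ∷ w' ∷ ws) b (lastOf w' ws)) ≡ s
    ∑-alternating-end end≢w = begin
      sumℤ (alternating (w ∷ w' ∷ ws) b l)   ≡⟨ ∑-alternating w w' ws b l ⟩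
      sign b * δ l w + s * δ l l             ≡⟨ cong₂ (λ p q → sign b * p + s * q) (δ-≢ end≢w) (δ-refl l) ⟩
      sign b * 0ℤ + s * 1ℤ                   ≡⟨ only-second (sign b) s ⟩
      s                                      ∎
      where
      open ≡-Reasoning
      l : Fin K
      l = lastOf w' ws
      only-second : ∀ p q → p * 0ℤ + q * 1ℤ ≡ q
      only-second = solve-∀

    ∑-alternating-inner : ∀ {x} → x ≢ w → x ≢ lastOf w' ws → sumℤ (alternating (w ∷ w' ∷ ws) b x) ≡ 0ℤ
    ∑-alternating-inner {x} x≢w x≢end = begin
      sumℤ (alternating (w ∷ w' ∷ ws) b x)     ≡⟨ ∑-alternating w w' ws b x ⟩
      sign b * δ x w + s * δ x (lastOf w' ws)  ≡⟨ cong₂ (λ p q → sign b * p + s * q) (δ-≢ x≢w) (δ-≢ x≢end) ⟩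
      sign b * 0ℤ + s * 0ℤ                     ≡⟨ neither (sign b) s ⟩
      0ℤ                                       ∎
      where
      open ≡-Reasoning
      neither : ∀ p q → p * 0ℤ + q * 0ℤ ≡ 0ℤ
      neither = solve-∀

  lastOf-colour : {R : Fin K → Fin K → Set} (col : Fin K → Bool) → (∀ {x y} → R x y → col y ≡ not (col x)) →
                  (w w' : Fin K) (ws : List (Fin K)) → Linked R (w ∷ w' ∷ ws) →
                  col (lastOf w' ws) ≡ finalSign (w' ∷ ws) true xor col w
  lastOf-colour col proper w w' [] (Rww' ∷ _) = proper Rww'
  lastOf-colour col proper w w' (w'' ∷ ws) (Rww' ∷ linked) = begin
    col (lastOf w'' ws)                              ≡⟨ lastOf-colour col proper w' w'' ws linked ⟩
    finalSign (w'' ∷ ws) true xor col w'             ≡⟨ cong (finalSign (w'' ∷ ws) true xor_) (proper Rww') ⟩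
    finalSign (w'' ∷ ws) true xor not (col w)        ≡⟨ not-distribʳ-xor (finalSign (w'' ∷ ws) true) (col w) ⟨
    not (finalSign (w'' ∷ ws) true xor col w)        ≡⟨ not-distribˡ-xor (finalSign (w'' ∷ ws) true) (col w) ⟩
    not (finalSign (w'' ∷ ws) true) xor col w        ≡⟨ cong (_xor col w) (finalSign-not (w'' ∷ ws) true) ⟨
    finalSign (w'' ∷ ws) false xor col w             ∎
    where open ≡-Reasoning

  lastOf-snoc : (w : Fin K) (ws : List (Fin K)) (z : Fin K) → lastOf w (ws ++ [ z ]) ≡ z
  lastOf-snoc w [] z = refl
  lastOf-snoc w (w' ∷ ws) z = lastOf-snoc w' ws z

  lastOf-∈ : (w : Fin K) (ws : List (Fin K)) → lastOf w ws ∈ w ∷ ws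
  lastOf-∈ w [] = here refl
  lastOf-∈ w (w' ∷ ws) = there (lastOf-∈ w' ws)

  finalSign-snoc : (w' : Fin K) (ws : List (Fin K)) (z : Fin K) (b : Bool) →
                   finalSign (w' ∷ ws ++ [ z ]) b ≡ not (finalSign (w' ∷ ws) b)
  finalSign-snoc w' [] z b = refl
  finalSign-snoc w' (w'' ∷ ws) z b = finalSign-snoc w'' ws z (not b)

  Linked-snoc : {R : Fin K → Fin K → Set} {w z : Fin K} (ws : List (Fin K)) →
                Linked R (w ∷ ws) → R (lastOf w ws) z → Linked R (w ∷ ws ++ [ z ])
  Linked-snoc [] [-] Rwz = Rwz ∷ [-]
  Linked-snoc (w' ∷ ws) (Rww' ∷ linked) Rz = Rww' ∷ Linked-snoc ws linked Rz

  alternating-snoc : (w w' : Fin K) (ws : List (Fin K)) (z : Fin K) (b : Bool) (x y : Fin K) →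
                     alternating (w ∷ w' ∷ ws ++ [ z ]) b x y ≡
                     alternating (w ∷ w' ∷ ws) b x y + sign (not (finalSign (w' ∷ ws) b)) * edgeδ (lastOf w' ws) z x y
  alternating-snoc w w' [] z b x y = begin
    sign b * edgeδ w w' x y + (sign (not b) * edgeδ w' z x y + 0ℤ)
      ≡⟨ cong (sign b * edgeδ w w' x y +_) (ℤP.+-identityʳ (sign (not b) * edgeδ w' z x y)) ⟩
    sign b * edgeδ w w' x y + sign (not b) * edgeδ w' z x y
      ≡⟨ cong (_+ sign (not b) * edgeδ w' z x y) (ℤP.+-identityʳ (sign b * edgeδ w w' x y)) ⟨
    sign b * edgeδ w w' x y + 0ℤ + sign (not b) * edgeδ w' z x y ∎
    where open ≡-Reasoning
  alternating-snoc w w' (w'' ∷ ws) z b x y =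
    trans (cong (sign b * edgeδ w w' x y +_) (alternating-snoc w' w'' ws z (not b) x y))
          (sym (ℤP.+-assoc (sign b * edgeδ w w' x y) (alternating (w' ∷ w'' ∷ ws) (not b) x y) _))

  ∑-closed : (w w' : Fin K) (ws : List (Fin K)) (b : Bool) (x : Fin K) →
             sumℤ (alternating (w ∷ w' ∷ ws ++ [ w ]) b x) ≡ (sign b + sign (not (finalSign (w' ∷ ws) b))) * δ x w
  ∑-closed w w' ws b x = begin
    sumℤ (alternating (w ∷ w' ∷ ws ++ [ w ]) b x)
      ≡⟨ ∑-alternating w w' (ws ++ [ w ]) b x ⟩
    sign b * δ x w + sign (finalSign (w' ∷ ws ++ [ w ]) b) * δ x (lastOf w' (ws ++ [ w ]))
      ≡⟨ cong₂ (λ s l → sign b * δ x w + sign s * δ x l) (finalSign-snoc w' ws w b) (lastOf-snoc w' ws w) ⟩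
    sign b * δ x w + sign (not (finalSign (w' ∷ ws) b)) * δ x w
      ≡⟨ ℤP.*-distribʳ-+ (δ x w) (sign b) _ ⟨
    (sign b + sign (not (finalSign (w' ∷ ws) b))) * δ x w ∎
    where open ≡-Reasoning

  ∑-closed-start : (w w' : Fin K) (ws : List (Fin K)) (b : Bool) →
                   sumℤ (alternating (w ∷ w' ∷ ws ++ [ w ]) b w) ≡ sign b + sign (not (finalSign (w' ∷ ws) b))
  ∑-closed-start w w' ws b = trans (∑-closed w w' ws b w) (trans (cong (weight *_) (δ-refl w)) (ℤP.*-identityʳ weight))
    where
    weight : ℤ
    weight = sign b + sign (not (finalSign (w' ∷ ws) b))

  ∑-closed-elsewhere : (w w' : Fin K) (ws : List (Fin K)) (b : Bool) {x : Fin K} → x ≢ w →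
                       sumℤ (alternating (w ∷ w' ∷ ws ++ [ w ]) b x) ≡ 0ℤ
  ∑-closed-elsewhere w w' ws b x≢w = trans (∑-closed w w' ws b _) (trans (cong (weight *_) (δ-≢ x≢w)) (ℤP.*-zeroʳ weight))
    where
    weight : ℤ
    weight = sign b + sign (not (finalSign (w' ∷ ws) b))

  module Closed (w w' : Fin K) (ws : List (Fin K)) (w∉ : w ∉ w' ∷ ws) (long : lastOf w' ws ≢ w') where

    private
      l : Fin K
      l = lastOf w' ws
      l≢w : l ≢ w
      l≢w l≡w = w∉ (subst (_∈ w' ∷ ws) l≡w (lastOf-∈ w' ws))

    closing-≡0 : (b : Bool) {x y : Fin K} → ¬ (x ≡ l × y ≡ w) → ¬ (x ≡ w × y ≡ l) →
                 alternating (w ∷ w' ∷ ws ++ [ w ]) b x y ≡ alternating (w ∷ w' ∷ ws) b x y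
    closing-≡0 b {x} {y} ¬xy ¬yx = begin
      alternating (w ∷ w' ∷ ws ++ [ w ]) b x y                  ≡⟨ alternating-snoc w w' ws w b x y ⟩
      alternating (w ∷ w' ∷ ws) b x y + s * edgeδ l w x y       ≡⟨ cong (λ e → alternating (w ∷ w' ∷ ws) b x y + s * e) (edgeδ-≡0 ¬xy ¬yx) ⟩
      alternating (w ∷ w' ∷ ws) b x y + s * 0ℤ                  ≡⟨ cong (alternating (w ∷ w' ∷ ws) b x y +_) (ℤP.*-zeroʳ s) ⟩
      alternating (w ∷ w' ∷ ws) b x y + 0ℤ                      ≡⟨ ℤP.+-identityʳ _ ⟩
      alternating (w ∷ w' ∷ ws) b x y                           ∎
      where
      open ≡-Reasoning
      s : ℤ
      s = sign (not (finalSign (w' ∷ ws) b))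

    closed-head : (b : Bool) → alternating (w ∷ w' ∷ ws ++ [ w ]) b w w' ≡ sign b
    closed-head b = trans (closing-≡0 b (l≢w ∘ sym ∘ proj₁) (long ∘ sym ∘ proj₂)) (alternating-head w w' ws b w∉)

    closing-edge : (b : Bool) → alternating (w ∷ w' ∷ ws ++ [ w ]) b l w ≡ sign (not (finalSign (w' ∷ ws) b))
    closing-edge b = begin
      alternating (w ∷ w' ∷ ws ++ [ w ]) b l w            ≡⟨ alternating-snoc w w' ws w b l w ⟩
      alternating (w ∷ w' ∷ ws) b l w + s * edgeδ l w l w ≡⟨ cong₂ (λ p e → p + s * e) path-part (edgeδ-≡1 l≢w) ⟩
      0ℤ + s * 1ℤ                                         ≡⟨ ℤP.+-identityˡ _ ⟩
      s * 1ℤ                                              ≡⟨ ℤP.*-identityʳ s ⟩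
      s                                                   ∎
      where
      open ≡-Reasoning
      s : ℤ
      s = sign (not (finalSign (w' ∷ ws) b))
      path-part : alternating (w ∷ w' ∷ ws) b l w ≡ 0ℤ
      path-part = trans (alternating-cons-≡ w w' ws b (edgeδ-≡0 (l≢w ∘ proj₁) (long ∘ proj₁)))
                        (alternating-∉ʳ (w' ∷ ws) (not b) l w∉)

    closed-unitOrZero : Unique (w ∷ w' ∷ ws) → (b : Bool) (x y : Fin K) → UnitOrZero (alternating (w ∷ w' ∷ ws ++ [ w ]) b x y)
    closed-unitOrZero u b x y with (x ≟ l ×-dec y ≟ w) | (x ≟ w ×-dec y ≟ l)
    ... | yes (refl , refl) | _ = subst UnitOrZero (sym (closing-edge b)) (inj₂ (_ , refl))
    ... | no _ | yes (refl , refl) =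
      subst UnitOrZero (sym (trans (alternating-sym (w ∷ w' ∷ ws ++ [ w ]) b x y) (closing-edge b))) (inj₂ (_ , refl))
    ... | no ¬xy | no ¬yx = subst UnitOrZero (sym (closing-≡0 b ¬xy ¬yx)) (alternating-unitOrZero (w ∷ w' ∷ ws) b x y u)

open AlternatingWalks

module IntegralRounding where

  open import Data.Nat as ℕ using (ℕ; zero; suc; pred; _+_; _*_; _∸_; _≤_; _<_; _<?_; z≤n; s≤s; NonZero)
  import Data.Nat.Properties as ℕP
  open import Data.Nat.DivMod
    using (_%_; _/_; 0/n≡0; m%n%n≡m%n; m≡m%n+[m/n]*n; [m+kn]%n≡m%n; m<n⇒m%n≡m; n%n≡0; m%n<n; %-congˡ; m*n%n≡0)
  open import Data.Nat.Tactic.RingSolver using (solve-∀)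
  open import Data.Integer as ℤ using (ℤ; +_; -[1+_]; 0ℤ; 1ℤ; -1ℤ)
  import Data.Integer.Properties as ℤP
  open import Data.Bool using (Bool; true; false; not; if_then_else_; _xor_)
  open import Data.Bool.Properties using (not-¬)
  open import Data.Fin using (Fin; zero; suc)
  open import Data.Fin.Properties using (_≟_; any?)
  open import Data.List using (List; []; _∷_; _++_; [_])
  open import Data.List.Properties using (++-assoc)
  open import Data.List.Membership.Propositional using (_∈_; _∉_)
  open import Data.List.Membership.Propositional.Properties using (∈-∃++)
  open import Data.List.Relation.Unary.All using ([]; _∷_)
  open import Data.List.Relation.Unary.All.Properties using (¬Any⇒All¬)
  open import Data.List.Relation.Unary.AllPairs using ([]; _∷_)
  open import Data.List.Relation.Unary.Any using (here; there)
  open import Data.List.Relation.Unary.Linked using (Linked; []; [-]; _∷_; head)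
  open import Data.List.Relation.Unary.Unique.Propositional using (Unique)
  open import Data.Product using (_×_; _,_; proj₁; proj₂; ∃-syntax)
  open import Data.Sum using (_⊎_; inj₁; inj₂; reduce)
  open import Function using (_∘_)
  open import Relation.Nullary using (¬_; contradiction; Dec; yes; no; ¬?; does; _×-dec_)
  open import Relation.Nullary.Decidable using (decidable-stable)
  open import Relation.Binary.PropositionalEquality hiding ([_])

  Matrix : ℕ → Set
  Matrix K = Fin K → Fin K → ℕ

  deg : ∀ {K} → Matrix K → Fin K → ℕ
  deg a v = sum (a v)

  record Bounded {K} (cap : ℕ) (lo hi : Fin K → ℕ) (a : Matrix K) : Set where
    field
      symmetric : ∀ u v → a u v ≡ a v u
      loopless  : ∀ v → a v v ≡ 0
      capped    : ∀ u v → a u v ≤ cap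
      lower     : ∀ v → lo v ≤ deg a v
      upper     : ∀ v → deg a v ≤ hi v

  sum-linear : ∀ {K} (f g e h : Fin K → ℕ) → (∀ i → f i + g i + 2 * e i ≡ 2 * h i) →
               sum f + sum g + 2 * sum e ≡ 2 * sum h
  sum-linear f g e h pointwise = begin
    sum f + sum g + 2 * sum e                   ≡⟨ cong₂ _+_ (sym (∑-distrib-+ f g)) (*-distribˡ-sum 2 e) ⟩
    sum (λ i → f i + g i) + sum (λ i → 2 * e i) ≡⟨ ∑-distrib-+ (λ i → f i + g i) (λ i → 2 * e i) ⟨
    sum (λ i → f i + g i + 2 * e i)             ≡⟨ sum-cong-≗ pointwise ⟩
    sum (λ i → 2 * h i)                         ≡⟨ *-distribˡ-sum 2 h ⟨
    2 * sum h                                   ∎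
    where open ≡-Reasoning

  +-injective-+1 : ∀ {T S} → + T ≡ + S ℤ.+ 1ℤ → T ≡ suc S
  +-injective-+1 {T} {S} eq = trans (ℤP.+-injective eq) (ℕP.+-comm S 1)

  +-injective-−1 : ∀ {T S} → + T ≡ + S ℤ.+ -1ℤ → suc T ≡ S
  +-injective-−1 {S = zero} ()
  +-injective-−1 {S = suc S} eq = cong suc (ℤP.+-injective eq)

  +-injective-−2 : ∀ {T S} → + T ≡ + S ℤ.+ -[1+ 1 ] → T + 2 ≡ S
  +-injective-−2 {S = zero} ()
  +-injective-−2 {S = suc zero} ()
  +-injective-−2 {T} {S = suc (suc S)} eq = trans (ℕP.+-comm T 2) (cong (_+_ 2) (ℤP.+-injective eq))

  module Defect (D : ℕ) .{{_ : NonZero D}} where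

    -- vanishes exactly on multiples of D and is strictly concave between them
    defect : ℕ → ℕ
    defect x = x % D * (D ∸ x % D)

    defect-of : ∀ ρ q → ρ ≤ D → defect (ρ + q * D) ≡ ρ * (D ∸ ρ)
    defect-of ρ q ρ≤D with ℕP.m≤n⇒m<n∨m≡n ρ≤D
    ... | inj₁ ρ<D = cong (λ r → r * (D ∸ r)) (trans ([m+kn]%n≡m%n ρ q D) (m<n⇒m%n≡m ρ<D))
    ... | inj₂ refl = begin
      (D + q * D) % D * (D ∸ (D + q * D) % D) ≡⟨ cong (λ r → r * (D ∸ r)) (trans ([m+kn]%n≡m%n D q D) (n%n≡0 D)) ⟩
      0                                       ≡⟨ ℕP.*-zeroʳ D ⟨
      D * 0                                   ≡⟨ cong (D *_) (ℕP.n∸n≡0 D) ⟨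
      D * (D ∸ D)                             ∎
      where open ≡-Reasoning

    -- here x % D = 1 + p
    defect-around : ∀ x → x % D ≢ 0 → ∃[ p ] ∃[ t ] D ≡ 2 + p + t
                      × defect (suc x) ≡ (2 + p) * t × defect (pred x) ≡ p * (2 + t) × defect x ≡ (1 + p) * (1 + t)
    defect-around x x≢0 with x % D in ρ≡
    ... | zero = contradiction refl x≢0
    ... | suc p = p , t , D≡ , trans (cong (defect ∘ suc) x≡) (defect-of (2 + p) q ρ<D)
                     , trans (cong defect (cong pred x≡)) (trans (defect-of p q (ℕP.<⇒≤ (ℕP.<-trans (ℕP.n<1+n p) ρ<D))) (cong (p *_) D∸p))
                     , cong (suc p *_) D∸1+p
      where
      q : ℕ
      q = x / D
      ρ<D : suc p < D
      ρ<D = subst (_< D) ρ≡ (m%n<n x D)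
      x≡ : x ≡ suc p + q * D
      x≡ = trans (m≡m%n+[m/n]*n x D) (cong (_+ q * D) ρ≡)
      t : ℕ
      t = D ∸ (2 + p)
      D≡ : D ≡ 2 + p + t
      D≡ = sym (ℕP.m+[n∸m]≡n ρ<D)
      D∸1+p : D ∸ suc p ≡ suc t
      D∸1+p = trans (cong (_∸ suc p) (trans D≡ (sym (ℕP.+-suc (suc p) t)))) (ℕP.m+n∸m≡n (suc p) (suc t))
      D∸p : D ∸ p ≡ 2 + t
      D∸p = trans (cong (_∸ p) (trans D≡ (regroup p t))) (ℕP.m+n∸m≡n p (2 + t))
        where
        regroup : ∀ p t → 2 + p + t ≡ p + (2 + t)
        regroup = solve-∀

    defect-step : ∀ x → x % D ≢ 0 → defect (suc x) + defect (pred x) + 2 ≡ 2 * defect x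
    defect-step x x≢0 with defect-around x x≢0
    ... | p , t , _ , e₊ , e₋ , e rewrite e₊ | e₋ | e = concavity p t
      where
      concavity : ∀ p t → (2 + p) * t + p * (2 + t) + 2 ≡ 2 * ((1 + p) * (1 + t))
      concavity = solve-∀

    defect-step-halves : D ≡ 2 → ∀ x → x % D ≢ 0 → defect (suc x) ≡ defect (pred x)
    defect-step-halves D≡2 x x≢0 with defect-around x x≢0
    ... | p , t , D≡ , e₊ , e₋ , _ with ℕP.+-cancelˡ-≡ 2 (p + t) 0 (trans (sym (ℕP.+-assoc 2 p t)) (trans (sym D≡) D≡2))
    ... | p+t≡0 rewrite ℕP.m+n≡0⇒m≡0 p p+t≡0 | ℕP.m+n≡0⇒n≡0 p p+t≡0 = trans e₊ (sym e₋)

  module Rounding {K : ℕ} (D : ℕ) .{{_ : NonZero D}} (cap : ℕ) (lo hi : Fin K → ℕ) (a₀ : Matrix K) where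

    open Defect D
    open import Data.List.Membership.DecPropositional {A = Fin K} _≟_ using (_∈?_)

    Fractional : Matrix K → Fin K → Fin K → Set
    Fractional a u v = a u v % D ≢ 0

    data Regime : Set where
      bipartite : (col : Fin K → Bool) → (∀ {u v} → Fractional a₀ u v → col v ≡ not (col u)) → Regime
      halves    : D ≡ 2 → (∀ v → lo v < hi v) → Regime

    record Invariant (a : Matrix K) : Set where
      field
        bounded        : Bounded (D * cap) (λ v → D * lo v) (λ v → D * hi v) a
        keeps-integral : ∀ u v → a₀ u v % D ≡ 0 → a u v ≡ a₀ u v
      open Bounded bounded public

    potential : Matrix K → ℕ
    potential a = sum (λ u → sum (λ v → defect (a u v)))

    _⊕_ : Matrix K → (Fin K → Fin K → ℤ) → Matrix K
    (a ⊕ c) x y = ℤ.∣ + a x y ℤ.+ c x y ∣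

    mass : (Fin K → Fin K → ℤ) → ℕ
    mass c = sum (λ u → sum (λ v → ℤ.∣ c u v ∣))

    InRange : Fin K → ℕ → Set
    InRange v T = D * lo v ≤ T × T ≤ D * hi v

    record Improvement (a : Matrix K) : Set where
      field
        next      : Matrix K
        invariant : Invariant next
        smaller   : potential next < potential a

    0%D : 0 % D ≡ 0
    0%D = m*n%n≡0 0 D

    multiple%D : ∀ k → (D * k) % D ≡ 0
    multiple%D k = trans (%-congˡ (ℕP.*-comm D k)) (m*n%n≡0 k D)

    either-below : ∀ x y e h → x + y + 2 * e ≡ 2 * h → 1 ≤ e → x < h ⊎ y < h
    either-below x y e h eq 1≤e with x <? h | y <? h
    ... | yes x<h | _ = inj₁ x<h
    ... | no _ | yes y<h = inj₂ y<h
    ... | no x≮h | no y≮h = contradiction eq (ℕP.<⇒≢ (begin-strict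
      2 * h             ≡⟨ cong (_+_ h) (ℕP.+-identityʳ h) ⟩
      h + h             ≡⟨ ℕP.+-identityʳ (h + h) ⟨
      h + h + 0         <⟨ ℕP.+-mono-≤-< (ℕP.+-mono-≤ (ℕP.≮⇒≥ x≮h) (ℕP.≮⇒≥ y≮h)) (ℕP.*-monoʳ-< 2 1≤e) ⟩
      x + y + 2 * e     ∎) ∘ sym)
      where open ℕP.≤-Reasoning

    module Step {a : Matrix K} (inv : Invariant a) where
      open Invariant inv

      F : Fin K → Fin K → Set
      F = Fractional a

      F? : ∀ u v → Dec (F u v)
      F? u v = ¬? (a u v % D ℕ.≟ 0)

      F-sym : ∀ {u v} → F u v → F v u
      F-sym {u} {v} f = f ∘ trans (cong (_% D) (symmetric u v))

      F-irrefl : ∀ v → ¬ F v v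
      F-irrefl v f = f (trans (cong (_% D) (loopless v)) 0%D)

      F-suc : ∀ {x y} → F x y → a x y ≡ suc (pred (a x y))
      F-suc {x} {y} f with a x y
      ... | zero = contradiction 0%D f
      ... | suc _ = refl

      F-<cap : ∀ {x y} → F x y → a x y < D * cap
      F-<cap {x} {y} f = ℕP.≤∧≢⇒< (capped x y) (λ eq → f (trans (cong (_% D) eq) (multiple%D cap)))

      Free : Fin K → Set
      Free v = deg a v % D ≢ 0

      Free? : ∀ v → Dec (Free v)
      Free? v = ¬? (deg a v % D ℕ.≟ 0)

      ⊕-zero : (c : Fin K → Fin K → ℤ) {x y : Fin K} → c x y ≡ 0ℤ → (a ⊕ c) x y ≡ a x y
      ⊕-zero c {x} {y} eq rewrite eq = ℕP.+-identityʳ (a x y)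

      ⊕-one : (c : Fin K → Fin K → ℤ) {x y : Fin K} → c x y ≡ 1ℤ → (a ⊕ c) x y ≡ suc (a x y)
      ⊕-one c {x} {y} eq rewrite eq = ℕP.+-comm (a x y) 1

      ⊕-minus-one : (c : Fin K → Fin K → ℤ) {x y : Fin K} → F x y → c x y ≡ -1ℤ → (a ⊕ c) x y ≡ pred (a x y)
      ⊕-minus-one c {x} {y} f eq rewrite eq | F-suc f = refl

      sign≢0 : ∀ b → sign b ≢ 0ℤ
      sign≢0 true ()
      sign≢0 false ()

      module Apply (c : Fin K → Fin K → ℤ) (unit : ∀ x y → UnitOrZero (c x y)) (supp : ∀ x y → c x y ≢ 0ℤ → F x y) where

        signed-fractional : ∀ {x y} b → c x y ≡ sign b → F x y
        signed-fractional {x} {y} b eq = supp x y (sign≢0 b ∘ trans (sym eq))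

        off-support : ∀ x y → ¬ F x y → c x y ≡ 0ℤ
        off-support x y ¬f with unit x y
        ... | inj₁ eq = eq
        ... | inj₂ (b , eq) = contradiction (signed-fractional b eq) ¬f

        ⊕-unchanged : ∀ x y → ¬ F x y → (a ⊕ c) x y ≡ a x y
        ⊕-unchanged x y ¬f = ⊕-zero c (off-support x y ¬f)

        ⊕-+ : ∀ x y → + (a ⊕ c) x y ≡ + a x y ℤ.+ c x y
        ⊕-+ x y with unit x y
        ... | inj₁ eq rewrite ⊕-zero c eq | eq = sym (ℤP.+-identityʳ _)
        ... | inj₂ (true , eq) rewrite ⊕-one c eq | eq = trans (cong +_ (ℕP.+-comm 1 (a x y))) (ℤP.pos-+ (a x y) 1)
        ... | inj₂ (false , eq) rewrite ⊕-minus-one c (signed-fractional false eq) eq | eq | F-suc (signed-fractional false eq) = refl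

        deg-⊕ : ∀ v → + deg (a ⊕ c) v ≡ + deg a v ℤ.+ sumℤ (c v)
        deg-⊕ v = begin
          + deg (a ⊕ c) v                               ≡⟨ pos-sum ((a ⊕ c) v) ⟩
          sumℤ (λ y → + (a ⊕ c) v y)                     ≡⟨ ℤ∑.sum-cong-≗ (⊕-+ v) ⟩
          sumℤ (λ y → + a v y ℤ.+ c v y)                 ≡⟨ ℤ∑.∑-distrib-+ (λ y → + a v y) (c v) ⟩
          sumℤ (λ y → + a v y) ℤ.+ sumℤ (c v)            ≡⟨ cong (ℤ._+ sumℤ (c v)) (pos-sum (a v)) ⟨
          + deg a v ℤ.+ sumℤ (c v)                       ∎
          where open ≡-Reasoning

        ⊕-capped : ∀ x y → (a ⊕ c) x y ≤ D * cap
        ⊕-capped x y with unit x y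
        ... | inj₁ eq = subst (_≤ D * cap) (sym (⊕-zero c eq)) (capped x y)
        ... | inj₂ (true , eq) = subst (_≤ D * cap) (sym (⊕-one c eq)) (F-<cap (signed-fractional true eq))
        ... | inj₂ (false , eq) = subst (_≤ D * cap) (sym (⊕-minus-one c (signed-fractional false eq) eq))
                                        (ℕP.≤⇒pred≤ (capped x y))

        ⊕-invariant : (∀ x y → c x y ≡ c y x) → (∀ v → InRange v (deg (a ⊕ c) v)) → Invariant (a ⊕ c)
        ⊕-invariant c-sym in-range = record
          { bounded = record
            { symmetric = λ x y → cong₂ (λ p q → ℤ.∣ + p ℤ.+ q ∣) (symmetric x y) (c-sym x y)
            ; loopless = λ v → trans (⊕-unchanged v v (F-irrefl v)) (loopless v)
            ; capped = ⊕-capped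
            ; lower = proj₁ ∘ in-range
            ; upper = proj₂ ∘ in-range
            }
          ; keeps-integral = λ u v integral → trans (⊕-unchanged u v (λ f → f (trans (cong (_% D) (keeps-integral u v integral)) integral)))
                                                    (keeps-integral u v integral)
          }

      module Pair (c c' : Fin K → Fin K → ℤ) (unit : ∀ x y → UnitOrZero (c x y)) (supp : ∀ x y → c x y ≢ 0ℤ → F x y)
                  (opposite : ∀ x y → c' x y ≡ ℤ.- c x y) where

        opposite-of : ∀ {x y z} → c x y ≡ z → c' x y ≡ ℤ.- z
        opposite-of {x} {y} eq = trans (opposite x y) (cong ℤ.-_ eq)

        data Effect (x y : Fin K) : Set where
          unchanged : c x y ≡ 0ℤ → (a ⊕ c) x y ≡ a x y → (a ⊕ c') x y ≡ a x y → Effect x y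
          up        : F x y → ℤ.∣ c x y ∣ ≡ 1 → (a ⊕ c) x y ≡ suc (a x y) → (a ⊕ c') x y ≡ pred (a x y) → Effect x y
          down      : F x y → ℤ.∣ c x y ∣ ≡ 1 → (a ⊕ c) x y ≡ pred (a x y) → (a ⊕ c') x y ≡ suc (a x y) → Effect x y

        effect : ∀ x y → Effect x y
        effect x y with unit x y
        ... | inj₁ eq = unchanged eq (⊕-zero c eq) (⊕-zero c' (opposite-of eq))
        ... | inj₂ (true , eq) = up f (cong ℤ.∣_∣ eq) (⊕-one c eq) (⊕-minus-one c' f (opposite-of eq))
          where f = supp x y (sign≢0 true ∘ trans (sym eq))
        ... | inj₂ (false , eq) = down f (cong ℤ.∣_∣ eq) (⊕-minus-one c f eq) (⊕-one c' (opposite-of eq))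
          where f = supp x y (sign≢0 false ∘ trans (sym eq))

        defect-pair : ∀ x y → defect ((a ⊕ c) x y) + defect ((a ⊕ c') x y) + 2 * ℤ.∣ c x y ∣ ≡ 2 * defect (a x y)
        defect-pair x y with effect x y
        ... | unchanged c≡0 e e' rewrite e | e' | c≡0 = double (defect (a x y))
          where
          double : ∀ d → d + d + 2 * 0 ≡ 2 * d
          double = solve-∀
        ... | up f ∣c∣≡1 e e' rewrite e | e' | ∣c∣≡1 = defect-step (a x y) f
        ... | down f ∣c∣≡1 e e' rewrite e | e' | ∣c∣≡1 =
          trans (cong (_+ 2) (ℕP.+-comm (defect (pred (a x y))) (defect (suc (a x y))))) (defect-step (a x y) f)

        potential-pair : potential (a ⊕ c) + potential (a ⊕ c') + 2 * mass c ≡ 2 * potential a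
        potential-pair = sum-linear _ _ _ _ (λ u → sum-linear _ _ _ _ (defect-pair u))

        mass-pos : ∀ {x₀ y₀} → c x₀ y₀ ≢ 0ℤ → 1 ≤ mass c
        mass-pos {x₀} {y₀} c≢0 = ℕP.≤-trans (ℕP.n≢0⇒n>0 (c≢0 ∘ ℤP.∣i∣≡0⇒i≡0))
          (ℕP.≤-trans (≤-sum (λ v → ℤ.∣ c x₀ v ∣) y₀) (≤-sum (λ u → sum (λ v → ℤ.∣ c u v ∣)) x₀))

        potential-drops : ∀ {x₀ y₀} → c x₀ y₀ ≢ 0ℤ → potential (a ⊕ c) < potential a ⊎ potential (a ⊕ c') < potential a
        potential-drops c≢0 = either-below _ _ _ _ potential-pair (mass-pos c≢0)

        -- for D = 2 both changes give the same potential, so both decrease it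
        potential-drops-halves : D ≡ 2 → ∀ {x₀ y₀} → c x₀ y₀ ≢ 0ℤ → potential (a ⊕ c) < potential a
        potential-drops-halves D≡2 c≢0 = reduce (either-below _ _ _ _ pair (mass-pos c≢0))
          where
          same-defect : ∀ x y → defect ((a ⊕ c) x y) ≡ defect ((a ⊕ c') x y)
          same-defect x y with effect x y
          ... | unchanged _ e e' = cong defect (trans e (sym e'))
          ... | up f _ e e' rewrite e | e' = defect-step-halves D≡2 (a x y) f
          ... | down f _ e e' rewrite e | e' = sym (defect-step-halves D≡2 (a x y) f)
          pair : potential (a ⊕ c) + potential (a ⊕ c) + 2 * mass c ≡ 2 * potential a
          pair = trans (cong (λ p → potential (a ⊕ c) + p + 2 * mass c) (sum-cong-≗ (λ u → sum-cong-≗ (same-defect u)))) potential-pair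

      F⇒F₀ : ∀ {x y} → F x y → Fractional a₀ x y
      F⇒F₀ {x} {y} f integral = f (trans (cong (_% D) (keeps-integral x y integral)) integral)

      second-fractional : ∀ {v v'} → ¬ Free v → F v v' → ∃[ z ] F v z × z ≢ v'
      second-fractional {v} {v'} ¬free f with any? (λ z → F? v z ×-dec ¬? (z ≟ v'))
      ... | yes found = found
      ... | no none = contradiction degree-fractional ¬free
        where
        integral-elsewhere : ∀ z → z ≢ v' → a v z % D ≡ 0
        integral-elsewhere z z≢v' = decidable-stable (a v z % D ℕ.≟ 0) (λ fz → none (z , fz , z≢v'))
        degree-fractional : Free v
        degree-fractional deg≡0 = f (begin
          a v v' % D                        ≡⟨ m%n%n≡m%n (a v v') D ⟨
          a v v' % D % D                    ≡⟨ cong (_% D) (sum-single (λ z → a v z % D) v' integral-elsewhere) ⟨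
          sum (λ z → a v z % D) % D         ≡⟨ sum-% D (a v) ⟨
          deg a v % D                       ≡⟨ deg≡0 ⟩
          0                                 ∎)
          where open ≡-Reasoning

      record FreePath : Set where
        field
          w₀ w₁    : Fin K
          ws       : List (Fin K)
          unique   : Unique (w₀ ∷ w₁ ∷ ws)
          linked   : Linked F (w₀ ∷ w₁ ∷ ws)
          free-w₀  : Free w₀
          free-end : Free (lastOf w₁ ws)

      record Cycle : Set where
        field
          w₀ w₁        : Fin K
          ws           : List (Fin K)
          unique       : Unique (w₀ ∷ w₁ ∷ ws)
          linked       : Linked F (w₀ ∷ w₁ ∷ ws)
          long         : lastOf w₁ ws ≢ w₁
          closing      : F (lastOf w₁ ws) w₀
          integral-w₀  : ¬ Free w₀

      unvisited : List (Fin K) → ℕ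
      unvisited L = sum (λ z → if does (z ∈? L) then 0 else 1)

      unvisited-≤ : ∀ L → unvisited L ≤ K
      unvisited-≤ L = ℕP.≤-trans (sum-mono-≤ at-most-1) (ℕP.≤-reflexive (sum-const-1 K))
        where
        at-most-1 : ∀ z → (if does (z ∈? L) then 0 else 1) ≤ 1
        at-most-1 z with z ∈? L
        ... | yes _ = z≤n
        ... | no _ = s≤s z≤n

      unvisited-∷ : ∀ u L → u ∉ L → suc (unvisited (u ∷ L)) ≤ unvisited L
      unvisited-∷ u L u∉L = ℕP.≤-reflexive (begin
        suc (unvisited (u ∷ L))                         ≡⟨ ℕP.+-comm 1 _ ⟩
        unvisited (u ∷ L) + 1                           ≡⟨ cong (_+_ (unvisited (u ∷ L))) (trans (sum-single new u only-u) new-u) ⟨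
        unvisited (u ∷ L) + sum new                     ≡⟨ ∑-distrib-+ _ new ⟨
        sum (λ z → (if does (z ∈? u ∷ L) then 0 else 1) + new z) ≡⟨ sum-cong-≗ pointwise ⟩
        unvisited L                                     ∎)
        where
        open ≡-Reasoning
        new : Fin K → ℕ
        new z = if does (z ≟ u) then 1 else 0
        new-u : new u ≡ 1
        new-u with u ≟ u
        ... | yes _ = refl
        ... | no u≢u = contradiction refl u≢u
        only-u : ∀ z → z ≢ u → new z ≡ 0
        only-u z z≢u with z ≟ u
        ... | yes z≡u = contradiction z≡u z≢u
        ... | no _ = refl
        pointwise : ∀ z → (if does (z ∈? u ∷ L) then 0 else 1) + new z ≡ (if does (z ∈? L) then 0 else 1)
        pointwise z with z ∈? u ∷ L | z ∈? L | z ≟ u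
        ... | _          | yes z∈L | yes z≡u  = contradiction (subst (_∈ L) z≡u z∈L) u∉L
        ... | yes _      | yes _   | no _     = refl
        ... | yes _      | no _    | yes _    = refl
        ... | yes (here z≡u) | no _ | no z≢u  = contradiction z≡u z≢u
        ... | yes (there z∈L) | no z∉L | no _ = contradiction z∈L z∉L
        ... | no z∉uL    | yes z∈L | no _     = contradiction (there z∈L) z∉uL
        ... | no z∉uL    | _       | yes z≡u  = contradiction (here z≡u) z∉uL
        ... | no _       | no _    | no _     = refl

      record Extension (x x' : Fin K) (xs : List (Fin K)) : Set where
        field
          y y'     : Fin K
          ys       : List (Fin K)
          unique   : Unique (y ∷ y' ∷ ys)
          linked   : Linked F (y ∷ y' ∷ ys)
          maximal  : ∀ u → F y u → u ∈ y ∷ y' ∷ ys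
          same-end : lastOf y' ys ≡ lastOf x' xs

      extend : ∀ n x x' xs → unvisited (x ∷ x' ∷ xs) ≤ n → Unique (x ∷ x' ∷ xs) → Linked F (x ∷ x' ∷ xs) → Extension x x' xs
      extend n x x' xs bound unique linked with any? (λ u → F? x u ×-dec ¬? (u ∈? x ∷ x' ∷ xs))
      ... | no none = record
        { y = x ; y' = x' ; ys = xs ; unique = unique ; linked = linked ; same-end = refl
        ; maximal = λ u f → decidable-stable (u ∈? x ∷ x' ∷ xs) (λ u∉ → none (u , f , u∉)) }
      ... | yes (u , f , u∉) with n
      ...   | zero = contradiction (ℕP.≤-trans (unvisited-∷ u _ u∉) bound) λ ()
      ...   | suc n = record
        { y = y ; y' = y' ; ys = ys ; unique = unique′ ; linked = linked′ ; maximal = maximal ; same-end = same-end }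
        where
        open Extension (extend n u x (x' ∷ xs) (ℕP.≤-pred (ℕP.≤-trans (unvisited-∷ u _ u∉) bound))
                               (¬Any⇒All¬ _ u∉ ∷ unique) (F-sym f ∷ linked))
          renaming (unique to unique′; linked to linked′)

      cycle-at-head : ∀ y y' ys → Unique (y ∷ y' ∷ ys) → Linked F (y ∷ y' ∷ ys) →
                      (∀ u → F y u → u ∈ y ∷ y' ∷ ys) → ¬ Free y → Cycle
      cycle-at-head y y' ys unique linked@(f ∷ _) maximal ¬free with second-fractional ¬free f
      ... | z , fz , z≢y' = from-membership (maximal z fz)
        where
        from-membership : z ∈ y ∷ y' ∷ ys → Cycle
        from-membership (here z≡y) = contradiction (subst (F y) z≡y fz) (F-irrefl y)
        from-membership (there (here z≡y')) = contradiction z≡y' z≢y'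
        from-membership (there (there z∈ys)) with ∈-∃++ z∈ys
        ... | pre , post , refl = record
          { w₀ = y ; w₁ = y' ; ws = pre ++ [ z ]
          ; unique = Unique-prefix (y ∷ y' ∷ pre ++ [ z ]) (subst (λ l → Unique (y ∷ y' ∷ l)) (sym (++-assoc pre [ z ] post)) unique)
          ; linked = Linked-prefix (y ∷ y' ∷ pre ++ [ z ]) (subst (λ l → Linked F (y ∷ y' ∷ l)) (sym (++-assoc pre [ z ] post)) linked)
          ; long = z≢y' ∘ trans (sym (lastOf-snoc y' pre z))
          ; closing = subst (λ v → F v y) (sym (lastOf-snoc y' pre z)) (F-sym fz)
          ; integral-w₀ = ¬free
          }

      start-path : ∀ {s e} → F s e → Unique (s ∷ e ∷ [])
      start-path {s} {e} f = ((λ s≡e → F-irrefl e (subst (λ v → F v e) s≡e f)) ∷ []) ∷ [] ∷ []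

      NoFreeFractional : Set
      NoFreeFractional = ¬ (∃[ h ] Free h × ∃[ t ] F h t)

      from-extension : ∀ {s e} → F s e → Free e ⊎ NoFreeFractional → FreePath ⊎ Cycle
      from-extension {s} {e} f end with extend K s e [] (unvisited-≤ (s ∷ e ∷ [])) (start-path f) (f ∷ [-])
      ... | ext with Free? (Extension.y ext) | end
      ...   | no ¬free | _ = inj₂ (cycle-at-head y y' ys unique linked maximal ¬free)
        where open Extension ext
      ...   | yes free | inj₁ free-e = inj₁ (record
        { w₀ = y ; w₁ = y' ; ws = ys ; unique = unique ; linked = linked ; free-w₀ = free ; free-end = subst Free (sym same-end) free-e })
        where open Extension ext
      ...   | yes free | inj₂ no-free = contradiction (y , free , y' , head linked) no-free
        where open Extension ext

      search : ∀ {x₀ y₀} → F x₀ y₀ → FreePath ⊎ Cycle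
      search f₀ with any? (λ h → Free? h ×-dec any? (F? h))
      ... | yes (h , free-h , t , f) = from-extension (F-sym f) (inj₁ free-h)
      ... | no none = from-extension f₀ (inj₂ none)

      in-range-same : ∀ v {T} → + T ≡ + deg a v ℤ.+ 0ℤ → InRange v T
      in-range-same v eq rewrite ℤP.+-injective (trans eq (ℤP.+-identityʳ _)) = lower v , upper v

      in-range-free : ∀ v b {T} → Free v → + T ≡ + deg a v ℤ.+ sign b → InRange v T
      in-range-free v true free eq rewrite +-injective-+1 eq =
        ℕP.m≤n⇒m≤1+n (lower v) , ℕP.≤∧≢⇒< (upper v) (λ deg≡ → free (trans (cong (_% D) deg≡) (multiple%D (hi v))))
      in-range-free v false {T} free eq = ℕP.≤-pred lo<deg , ℕP.≤-trans (ℕP.n≤1+n T) (subst (_≤ D * hi v) deg≡ (upper v))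
        where
        deg≡ : deg a v ≡ suc T
        deg≡ = sym (+-injective-−1 eq)
        lo<deg : D * lo v < suc T
        lo<deg = subst (D * lo v <_) deg≡ (ℕP.≤∧≢⇒< (lower v) (λ lo≡ → free (trans (cong (_% D) (sym lo≡)) (multiple%D (lo v)))))

      module Moves (change : Bool → Fin K → Fin K → ℤ)
                   (unit : ∀ b x y → UnitOrZero (change b x y))
                   (supp : ∀ b x y → change b x y ≢ 0ℤ → F x y)
                   (change-sym : ∀ b x y → change b x y ≡ change b y x)
                   (change-not : ∀ b x y → change (not b) x y ≡ ℤ.- change b x y)
                   {x₀ y₀ : Fin K} (at-x₀y₀ : ∀ b → change b x₀ y₀ ≡ sign b) where

        InRangeAfter : Bool → Set
        InRangeAfter b = ∀ v → InRange v (deg (a ⊕ change b) v)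

        deg-move : ∀ b v {z} → sumℤ (change b v) ≡ z → + deg (a ⊕ change b) v ≡ + deg a v ℤ.+ z
        deg-move b v eq = trans (Apply.deg-⊕ (change b) (unit b) (supp b) v) (cong (ℤ._+_ (+ deg a v)) eq)

        move : ∀ b → InRangeAfter b → potential (a ⊕ change b) < potential a → Improvement a
        move b in-range smaller = record
          { next = a ⊕ change b
          ; invariant = Apply.⊕-invariant (change b) (unit b) (supp b) (change-sym b) in-range
          ; smaller = smaller }

        better-move : (∀ b → InRangeAfter b) → Improvement a
        better-move in-range with Pair.potential-drops (change true) (change false) (unit true) (supp true) (change-not true)
                                                       (sign≢0 true ∘ trans (sym (at-x₀y₀ true)))
        ... | inj₁ smaller = move true (in-range true) smaller
        ... | inj₂ smaller = move false (in-range false) smaller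

        move-halves : D ≡ 2 → ∀ b → InRangeAfter b → Improvement a
        move-halves D≡2 b in-range = move b in-range
          (Pair.potential-drops-halves (change b) (change (not b)) (unit b) (supp b) (change-not b) D≡2
                                       (sign≢0 b ∘ trans (sym (at-x₀y₀ b))))

      along-path : FreePath → Improvement a
      along-path p = better-move in-range
        where
        open FreePath p
        L : List (Fin K)
        L = w₀ ∷ w₁ ∷ ws
        w₀∉ : w₀ ∉ w₁ ∷ ws
        w₀∉ = unique-head unique
        end≢w₀ : lastOf w₁ ws ≢ w₀
        end≢w₀ end≡w₀ = w₀∉ (subst (_∈ w₁ ∷ ws) end≡w₀ (lastOf-∈ w₁ ws))
        open Moves (alternating L) (λ b x y → alternating-unitOrZero L b x y unique)
                   (λ b x y → alternating-support F-sym L b x y linked) (alternating-sym L) (alternating-not L)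
                   (λ b → alternating-head w₀ w₁ ws b w₀∉)
        in-range : ∀ b → InRangeAfter b
        in-range b v with v ≟ w₀ | v ≟ lastOf w₁ ws
        ... | yes refl | _ = in-range-free v b free-w₀ (deg-move b v (∑-alternating-start w₀ w₁ ws b end≢w₀))
        ... | no v≢w₀ | yes refl = in-range-free v (finalSign (w₁ ∷ ws) b) free-end (deg-move b v (∑-alternating-end w₀ w₁ ws b end≢w₀))
        ... | no v≢w₀ | no v≢end = in-range-same v (deg-move b v (∑-alternating-inner w₀ w₁ ws b v≢w₀ v≢end))

      multiple-degree : ∀ {w} → ¬ Free w → deg a w ≡ deg a w / D * D
      multiple-degree {w} ¬free =
        trans (m≡m%n+[m/n]*n (deg a w) D) (cong (_+ deg a w / D * D) (decidable-stable (deg a w % D ℕ.≟ 0) ¬free))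

      raise-in-range : 2 ≤ D → ∀ {w T} → ¬ Free w → deg a w / D < hi w → T ≡ deg a w + 2 → InRange w T
      raise-in-range 2≤D {w} ¬free q<hi refl = ℕP.≤-trans (lower w) (ℕP.m≤m+n _ 2) , (begin
        deg a w + 2              ≤⟨ ℕP.+-monoʳ-≤ (deg a w) 2≤D ⟩
        deg a w + D              ≡⟨ cong (_+ D) (multiple-degree ¬free) ⟩
        q * D + D                ≡⟨ ℕP.+-comm (q * D) D ⟩
        suc q * D                ≤⟨ ℕP.*-monoˡ-≤ D q<hi ⟩
        hi w * D                 ≡⟨ ℕP.*-comm (hi w) D ⟩
        D * hi w                 ∎)
        where
        open ℕP.≤-Reasoning
        q : ℕ
        q = deg a w / D

      lower-in-range : 2 ≤ D → ∀ {w T} → ¬ Free w → lo w < hi w → hi w ≤ deg a w / D → T + 2 ≡ deg a w → InRange w T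
      lower-in-range 2≤D {w} {T} ¬free lo<hi hi≤q T+2≡ = ℕP.+-cancelʳ-≤ 2 (D * lo w) T (begin
        D * lo w + 2             ≤⟨ ℕP.+-monoʳ-≤ (D * lo w) 2≤D ⟩
        D * lo w + D             ≡⟨ ℕP.+-comm (D * lo w) D ⟩
        D + D * lo w             ≡⟨ ℕP.*-suc D (lo w) ⟨
        D * suc (lo w)           ≤⟨ ℕP.*-monoʳ-≤ D lo<hi ⟩
        D * hi w                 ≤⟨ ℕP.*-monoʳ-≤ D hi≤q ⟩
        D * q                    ≡⟨ ℕP.*-comm D q ⟩
        q * D                    ≡⟨ multiple-degree ¬free ⟨
        deg a w                  ≡⟨ T+2≡ ⟨
        T + 2                    ∎) , ℕP.≤-trans (ℕP.≤-trans (ℕP.m≤m+n T 2) (ℕP.≤-reflexive T+2≡)) (upper w)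
        where
        open ℕP.≤-Reasoning
        q : ℕ
        q = deg a w / D

      around-cycle : Regime → Cycle → Improvement a
      around-cycle regime cyc = by-parity regime (finalSign (w₁ ∷ ws) true) refl
        where
        open Cycle cyc
        w₀∉ : w₀ ∉ w₁ ∷ ws
        w₀∉ = unique-head unique
        open Closed w₀ w₁ ws w₀∉ long
        L : List (Fin K)
        L = w₀ ∷ w₁ ∷ ws ++ [ w₀ ]
        open Moves (alternating L) (λ b → closed-unitOrZero unique b)
                   (λ b x y → alternating-support F-sym L b x y (Linked-snoc (w₁ ∷ ws) linked closing))
                   (alternating-sym L) (alternating-not L) closed-head

        weight : Bool → ℤ
        weight b = sign b ℤ.+ sign (not (finalSign (w₁ ∷ ws) b))

        row-w₀ : ∀ b → + deg (a ⊕ alternating L b) w₀ ≡ + deg a w₀ ℤ.+ weight b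
        row-w₀ b = deg-move b w₀ (∑-closed-start w₀ w₁ ws b)

        row-elsewhere : ∀ b v → v ≢ w₀ → + deg (a ⊕ alternating L b) v ≡ + deg a v ℤ.+ 0ℤ
        row-elsewhere b v v≢w₀ = deg-move b v (∑-closed-elsewhere w₀ w₁ ws b v≢w₀)

        even : finalSign (w₁ ∷ ws) true ≡ true → Improvement a
        even odd-path = better-move (λ b v → in-range-same v (deg-move b v (trans (∑-closed w₀ w₁ ws b v) (balanced b v))))
          where
          balanced : ∀ b v → weight b ℤ.* δ v w₀ ≡ 0ℤ
          balanced true v rewrite odd-path = ℤP.*-zeroˡ (δ v w₀)
          balanced false v rewrite finalSign-not (w₁ ∷ ws) true | odd-path = ℤP.*-zeroˡ (δ v w₀)

        odd-cycle-halves : D ≡ 2 → (∀ v → lo v < hi v) → finalSign (w₁ ∷ ws) true ≡ false → Improvement a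
        odd-cycle-halves D≡2 lo<hi even-path with deg a w₀ / D <? hi w₀
        ... | yes q<hi = move-halves D≡2 true in-range
          where
          in-range : InRangeAfter true
          in-range v with v ≟ w₀
          ... | no v≢w₀ = in-range-same v (row-elsewhere true v v≢w₀)
          ... | yes refl = raise-in-range (ℕP.≤-reflexive (sym D≡2)) integral-w₀ q<hi
            (ℤP.+-injective (trans (row-w₀ true) (cong (λ s → + deg a w₀ ℤ.+ (1ℤ ℤ.+ sign (not s))) even-path)))
        ... | no q≮hi = move-halves D≡2 false in-range
          where
          in-range : InRangeAfter false
          in-range v with v ≟ w₀
          ... | no v≢w₀ = in-range-same v (row-elsewhere false v v≢w₀)
          ... | yes refl = lower-in-range (ℕP.≤-reflexive (sym D≡2)) integral-w₀ (lo<hi v) (ℕP.≮⇒≥ q≮hi)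
            (+-injective-−2 (trans (row-w₀ false) (cong (λ s → + deg a w₀ ℤ.+ (-1ℤ ℤ.+ sign (not s)))
                                                        (trans (finalSign-not (w₁ ∷ ws) true) (cong not even-path)))))

        by-parity : Regime → ∀ s → finalSign (w₁ ∷ ws) true ≡ s → Improvement a
        by-parity _ true odd-path = even odd-path
        by-parity (halves D≡2 lo<hi) false even-path = odd-cycle-halves D≡2 lo<hi even-path
        by-parity (bipartite col proper) false even-path = contradiction colour-w₀ (not-¬ refl)
          where
          proper-F : ∀ {x y} → F x y → col y ≡ not (col x)
          proper-F = proper ∘ F⇒F₀
          colour-w₀ : col w₀ ≡ not (col w₀)
          colour-w₀ = begin
            col w₀                                   ≡⟨ proper-F closing ⟩
            not (col (lastOf w₁ ws))                 ≡⟨ cong not (lastOf-colour col proper-F w₀ w₁ ws linked) ⟩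
            not (finalSign (w₁ ∷ ws) true xor col w₀) ≡⟨ cong (λ s → not (s xor col w₀)) even-path ⟩
            not (col w₀)                             ∎
            where open ≡-Reasoning

      step : Regime → ∀ {x₀ y₀} → F x₀ y₀ → Improvement a
      step regime f with search f
      ... | inj₁ path = along-path path
      ... | inj₂ cyc = around-cycle regime cyc

    Rounded : Set
    Rounded = ∃[ x ] Bounded cap lo hi x × (∀ u v → a₀ u v ≡ 0 → x u v ≡ 0)

    integral-part : ∀ {a} → Invariant a → (∀ u v → a u v % D ≡ 0) → Rounded
    integral-part {a} inv integral = x , record
      { symmetric = λ u v → cong (_/ D) (symmetric u v)
      ; loopless  = λ v → trans (cong (_/ D) (loopless v)) (0/n≡0 D)
      ; capped    = λ u v → ℕP.*-cancelʳ-≤ (x u v) cap D (subst₂ _≤_ (a≡ u v) (ℕP.*-comm D cap) (capped u v))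
      ; lower     = λ v → ℕP.*-cancelʳ-≤ (lo v) (deg x v) D (subst₂ _≤_ (ℕP.*-comm D (lo v)) (deg≡ v) (lower v))
      ; upper     = λ v → ℕP.*-cancelʳ-≤ (deg x v) (hi v) D (subst₂ _≤_ (deg≡ v) (ℕP.*-comm D (hi v)) (upper v))
      } , support
      where
      open Invariant inv
      x : Matrix K
      x u v = a u v / D
      a≡ : ∀ u v → a u v ≡ x u v * D
      a≡ u v = trans (m≡m%n+[m/n]*n (a u v) D) (cong (_+ x u v * D) (integral u v))
      deg≡ : ∀ v → deg a v ≡ deg x v * D
      deg≡ v = trans (sum-cong-≗ (a≡ v)) (sym (*-distribʳ-sum D (x v)))
      support : ∀ u v → a₀ u v ≡ 0 → x u v ≡ 0
      support u v a₀≡0 = trans (cong (_/ D) (trans (keeps-integral u v (trans (cong (_% D) a₀≡0) 0%D)) a₀≡0)) (0/n≡0 D)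

    iterate : Regime → ∀ n {a} → potential a ≤ n → Invariant a → Rounded
    iterate regime n {a} bound inv with any? (λ u → any? (λ v → Step.F? inv u v))
    ... | no none = integral-part inv (λ u v → decidable-stable (a u v % D ℕ.≟ 0) (λ f → none (u , v , f)))
    ... | yes (u , v , f) with Step.step inv regime f | n
    ...   | better | zero = contradiction (ℕP.<-≤-trans (Improvement.smaller better) bound) ℕP.n≮0
    ...   | better | suc n = iterate regime n (ℕP.≤-pred (ℕP.<-≤-trans (Improvement.smaller better) bound)) (Improvement.invariant better)

    round : Regime → Bounded (D * cap) (λ v → D * lo v) (λ v → D * hi v) a₀ → Rounded
    round regime bounded = iterate regime (potential a₀) ℕP.≤-refl (record { bounded = bounded ; keeps-integral = λ _ _ _ → refl })

open IntegralRounding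

module BipartiteCover where

  open import Data.Nat using (ℕ; _+_; _*_; _≤_; _<_; z≤n; NonZero)
  import Data.Nat.Properties as ℕP
  open import Data.Nat.DivMod using (_%_)
  open import Data.Fin using (Fin; _↑ˡ_; _↑ʳ_; splitAt)
  open import Data.Fin.Properties using (splitAt-↑ˡ; splitAt-↑ʳ)
  open import Data.Bool using (Bool; true; false; not)
  open import Data.Sum using (_⊎_; inj₁; inj₂; [_,_]′)
  open import Data.Product using (_×_; _,_; ∃-syntax)
  open import Function using (id; _∘_)
  open import Relation.Nullary using (contradiction)
  open import Relation.Binary.PropositionalEquality

  module DoubleCover {N : ℕ} (D : ℕ) .{{_ : NonZero D}} (cap : ℕ) (lo hi : Fin N → ℕ) (A : Matrix N)
                     (A-bounded : Bounded (D * cap) (λ v → D * lo v) (λ v → D * hi v) A) where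

    open Bounded A-bounded

    -- the two copies of a vertex u are u ↑ˡ N and N ↑ʳ u
    Side : Set
    Side = Fin N ⊎ Fin N

    cover′ : Side → Side → ℕ
    cover′ (inj₁ u) (inj₂ v) = A u v
    cover′ (inj₂ u) (inj₁ v) = A v u
    cover′ _ _ = 0

    cover : Matrix (N + N)
    cover p q = cover′ (splitAt N p) (splitAt N q)

    project : Fin (N + N) → Fin N
    project p = [ id , id ]′ (splitAt N p)

    cover′-sym : ∀ s t → cover′ s t ≡ cover′ t s
    cover′-sym (inj₁ u) (inj₁ v) = refl
    cover′-sym (inj₁ u) (inj₂ v) = refl
    cover′-sym (inj₂ u) (inj₁ v) = refl
    cover′-sym (inj₂ u) (inj₂ v) = refl

    cover′-loopless : ∀ s → cover′ s s ≡ 0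
    cover′-loopless (inj₁ u) = refl
    cover′-loopless (inj₂ u) = refl

    cover′-capped : ∀ s t → cover′ s t ≤ D * cap
    cover′-capped (inj₁ u) (inj₁ v) = z≤n
    cover′-capped (inj₁ u) (inj₂ v) = capped u v
    cover′-capped (inj₂ u) (inj₁ v) = capped v u
    cover′-capped (inj₂ u) (inj₂ v) = z≤n

    deg-cover : ∀ p → deg cover p ≡ deg A (project p)
    deg-cover p = begin
      sum (cover p)                                                              ≡⟨ sum-↑ N N (cover p) ⟩
      sum (λ i → cover p (i ↑ˡ N)) + sum (λ i → cover p (N ↑ʳ i))                ≡⟨ cong₂ _+_ (sum-cong-≗ to-left) (sum-cong-≗ to-right) ⟩
      sum (λ i → cover′ (splitAt N p) (inj₁ i)) + sum (λ i → cover′ (splitAt N p) (inj₂ i)) ≡⟨ by-side (splitAt N p) ⟩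
      deg A (project p)                                                          ∎
      where
      open ≡-Reasoning
      to-left : ∀ i → cover p (i ↑ˡ N) ≡ cover′ (splitAt N p) (inj₁ i)
      to-left i = cong (cover′ (splitAt N p)) (splitAt-↑ˡ N i N)
      to-right : ∀ i → cover p (N ↑ʳ i) ≡ cover′ (splitAt N p) (inj₂ i)
      to-right i = cong (cover′ (splitAt N p)) (splitAt-↑ʳ N N i)
      by-side : ∀ s → sum (λ i → cover′ s (inj₁ i)) + sum (λ i → cover′ s (inj₂ i)) ≡ deg A ([ id , id ]′ s)
      by-side (inj₁ u) = cong (_+ deg A u) (sum-zero {N} (λ _ → 0) (λ _ → refl))
      by-side (inj₂ u) = trans (cong (sum (λ i → A i u) +_) (sum-zero {N} (λ _ → 0) (λ _ → refl)))
                               (trans (ℕP.+-identityʳ _) (sum-cong-≗ (λ i → symmetric i u)))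

    cover-bounded : Bounded (D * cap) (λ p → D * lo (project p)) (λ p → D * hi (project p)) cover
    cover-bounded = record
      { symmetric = λ p q → cover′-sym (splitAt N p) (splitAt N q)
      ; loopless  = λ p → cover′-loopless (splitAt N p)
      ; capped    = λ p q → cover′-capped (splitAt N p) (splitAt N q)
      ; lower     = λ p → subst (D * lo (project p) ≤_) (sym (deg-cover p)) (lower (project p))
      ; upper     = λ p → subst (_≤ D * hi (project p)) (sym (deg-cover p)) (upper (project p))
      }

    open Rounding D cap (lo ∘ project) (hi ∘ project) cover using (round; bipartite; Fractional; 0%D)

    isLeft : Side → Bool
    isLeft (inj₁ _) = true
    isLeft (inj₂ _) = false

    edges-cross : ∀ {p q} → Fractional cover p q → isLeft (splitAt N q) ≡ not (isLeft (splitAt N p))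
    edges-cross {p} {q} = crosses (splitAt N p) (splitAt N q)
      where
      crosses : ∀ s t → cover′ s t % D ≢ 0 → isLeft t ≡ not (isLeft s)
      crosses (inj₁ u) (inj₁ v) f = contradiction 0%D f
      crosses (inj₁ u) (inj₂ v) f = refl
      crosses (inj₂ u) (inj₁ v) f = refl
      crosses (inj₂ u) (inj₂ v) f = contradiction 0%D f

    L R : Fin N → Fin (N + N)
    L u = u ↑ˡ N
    R u = N ↑ʳ u

    project-L : ∀ u → project (L u) ≡ u
    project-L u = cong [ id , id ]′ (splitAt-↑ˡ N u N)

    project-R : ∀ u → project (R u) ≡ u
    project-R u = cong [ id , id ]′ (splitAt-↑ʳ N N u)

    cover-LR : ∀ u v → cover (L u) (R v) ≡ A u v
    cover-LR u v = cong₂ cover′ (splitAt-↑ˡ N u N) (splitAt-↑ʳ N N v)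

    fold : Matrix (N + N) → Matrix N
    fold x u v = x (L u) (R v) + x (L v) (R u)

    module Fold {x : Matrix (N + N)} (x-bounded : Bounded cap (lo ∘ project) (hi ∘ project) x)
                (x-support : ∀ p q → cover p q ≡ 0 → x p q ≡ 0) where

      module X = Bounded x-bounded

      x-LL : ∀ u v → x (L u) (L v) ≡ 0
      x-LL u v = x-support (L u) (L v) (cong₂ cover′ (splitAt-↑ˡ N u N) (splitAt-↑ˡ N v N))

      x-RR : ∀ u v → x (R u) (R v) ≡ 0
      x-RR u v = x-support (R u) (R v) (cong₂ cover′ (splitAt-↑ʳ N N u) (splitAt-↑ʳ N N v))

      deg-L : ∀ v → deg x (L v) ≡ sum (λ u → x (L v) (R u))
      deg-L v = trans (sum-↑ N N (x (L v))) (cong (_+ sum (λ u → x (L v) (R u))) (sum-zero (λ u → x (L v) (L u)) (x-LL v)))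

      deg-R : ∀ v → deg x (R v) ≡ sum (λ u → x (L u) (R v))
      deg-R v = trans (sum-↑ N N (x (R v)))
        (trans (cong₂ _+_ (sum-cong-≗ (λ u → X.symmetric (R v) (L u))) (sum-zero (λ u → x (R v) (R u)) (x-RR v))) (ℕP.+-identityʳ _))

      deg-fold : ∀ v → deg (fold x) v ≡ deg x (L v) + deg x (R v)
      deg-fold v = trans (∑-distrib-+ (λ u → x (L v) (R u)) (λ u → x (L u) (R v))) (sym (cong₂ _+_ (deg-L v) (deg-R v)))

      lower-copy : ∀ v p → project p ≡ v → lo v ≤ deg x p
      lower-copy v p refl = X.lower p

      upper-copy : ∀ v p → project p ≡ v → deg x p ≤ hi v
      upper-copy v p refl = X.upper p

      fold-bounded : Bounded (2 * cap) (λ v → 2 * lo v) (λ v → 2 * hi v) (fold x)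
      fold-bounded = record
        { symmetric = λ u v → ℕP.+-comm (x (L u) (R v)) (x (L v) (R u))
        ; loopless  = λ v → cong (λ z → z + z) (x-support (L v) (R v) (trans (cover-LR v v) (loopless v)))
        ; capped    = λ u v → subst (fold x u v ≤_) (twice cap) (ℕP.+-mono-≤ (X.capped (L u) (R v)) (X.capped (L v) (R u)))
        ; lower     = λ v → subst₂ _≤_ (twice (lo v)) (sym (deg-fold v))
                                       (ℕP.+-mono-≤ (lower-copy v (L v) (project-L v)) (lower-copy v (R v) (project-R v)))
        ; upper     = λ v → subst₂ _≤_ (sym (deg-fold v)) (twice (hi v))
                                       (ℕP.+-mono-≤ (upper-copy v (L v) (project-L v)) (upper-copy v (R v) (project-R v)))
        }
        where
        twice : ∀ n → n + n ≡ 2 * n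
        twice n = cong (n +_) (sym (ℕP.+-identityʳ n))

      fold-support : ∀ u v → A u v ≡ 0 → fold x u v ≡ 0
      fold-support u v A≡0 = cong₂ _+_ (x-support (L u) (R v) (trans (cover-LR u v) A≡0))
                                       (x-support (L v) (R u) (trans (cover-LR v u) (trans (symmetric v u) A≡0)))

    half-integral : ∃[ y ] Bounded (2 * cap) (λ v → 2 * lo v) (λ v → 2 * hi v) y × (∀ u v → A u v ≡ 0 → y u v ≡ 0)
    half-integral with round (bipartite (isLeft ∘ splitAt N) edges-cross) cover-bounded
    ... | x , x-bounded , x-support = fold x , Fold.fold-bounded x-bounded x-support , Fold.fold-support x-bounded x-support

  integral-factor : ∀ {N} (D : ℕ) .{{_ : NonZero D}} (cap : ℕ) (lo hi : Fin N → ℕ) → (∀ v → lo v < hi v) →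
                    (A : Matrix N) → Bounded (D * cap) (λ v → D * lo v) (λ v → D * hi v) A →
                    ∃[ x ] Bounded cap lo hi x × (∀ u v → A u v ≡ 0 → x u v ≡ 0)
  integral-factor D cap lo hi lo<hi A A-bounded with DoubleCover.half-integral D cap lo hi A A-bounded
  ... | y , y-bounded , y-support with Rounding.round 2 cap lo hi y (Rounding.halves refl lo<hi) y-bounded
  ...   | x , x-bounded , x-support = x , x-bounded , λ u v A≡0 → x-support u v (y-support u v A≡0)

open BipartiteCover

module Fractions where

  open import Data.Nat as ℕ using (ℕ; zero; suc; z<s)
  import Data.Nat.Properties as ℕP
  open import Data.Integer as ℤ using (ℤ; +_; -[1+_])
  import Data.Integer.Properties as ℤP
  open import Data.Integer.Tactic.RingSolver using (solve-∀)
  import Data.Nat.Tactic.RingSolver as ℕ-Solver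
  open import Data.Rational as ℚ using (ℚ; mkℚ; 0ℚ; 1ℚ; ↥_; ↧ₙ_; toℚᵘ)
  import Data.Rational.Properties as ℚP
  open import Data.Rational.Unnormalised as ℚᵘ using (mkℚᵘ; *≡*; *≤*) renaming (_≃_ to _≃ᵘ_)
  import Data.Rational.Unnormalised.Properties as ℚᵘP
  open import Data.Fin using (Fin; zero; suc)
  open import Function using (_∘_)
  open import Data.Nat.Divisibility using (_∣_; ∣-trans; m∣m*n; n∣m*n)
  open import Data.Product using (_×_; _,_; ∃-syntax)
  open import Algebra.Bundles using (CommutativeRing)
  open import Relation.Binary.PropositionalEquality

  import Algebra.Properties.Semiring.Sum as SemiringSum
  module ℚ∑ = SemiringSum (CommutativeRing.semiring ℚP.+-*-commutativeRing)

  toℚᵘ-frac : ∀ k d → toℚᵘ (frac k (suc d) z<s) ≃ᵘ mkℚᵘ (+ k) d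
  toℚᵘ-frac k d = ℚP.toℚᵘ-fromℚᵘ (mkℚᵘ (+ k) d)

  ≡-via-ℚᵘ : ∀ {p q r} → toℚᵘ p ≃ᵘ r → toℚᵘ q ≃ᵘ r → p ≡ q
  ≡-via-ℚᵘ p≃r q≃r = ℚP.toℚᵘ-injective (ℚᵘP.≃-trans p≃r (ℚᵘP.≃-sym q≃r))

  frac-+ : ∀ a b d → frac a (suc d) z<s ℚ.+ frac b (suc d) z<s ≡ frac (a ℕ.+ b) (suc d) z<s
  frac-+ a b d = ≡-via-ℚᵘ
    (ℚᵘP.≃-trans (ℚP.toℚᵘ-homo-+ (frac a (suc d) z<s) _) (ℚᵘP.≃-trans (ℚᵘP.+-cong (toℚᵘ-frac a d) (toℚᵘ-frac b d)) same-denominator))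
    (toℚᵘ-frac (a ℕ.+ b) d)
    where
    same-denominator : mkℚᵘ (+ a) d ℚᵘ.+ mkℚᵘ (+ b) d ≃ᵘ mkℚᵘ (+ (a ℕ.+ b)) d
    same-denominator = *≡* (trans (factor (+ a) (+ b) (+ suc d)) (sym (cong₂ ℤ._*_ (ℤP.pos-+ a b) (ℤP.pos-* (suc d) (suc d)))))
      where
      factor : ∀ x y s → (x ℤ.* s ℤ.+ y ℤ.* s) ℤ.* s ≡ (x ℤ.+ y) ℤ.* (s ℤ.* s)
      factor = solve-∀

  frac-* : ∀ a b d → frac a 1 z<s ℚ.* frac b (suc d) z<s ≡ frac (a ℕ.* b) (suc d) z<s
  frac-* a b d = ≡-via-ℚᵘ
    (ℚᵘP.≃-trans (ℚP.toℚᵘ-homo-* (frac a 1 z<s) _) (ℚᵘP.≃-trans (ℚᵘP.*-cong (toℚᵘ-frac a 0) (toℚᵘ-frac b d)) product))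
    (toℚᵘ-frac (a ℕ.* b) d)
    where
    product : mkℚᵘ (+ a) 0 ℚᵘ.* mkℚᵘ (+ b) d ≃ᵘ mkℚᵘ (+ (a ℕ.* b)) d
    product = *≡* (trans (cong (ℤ._* + suc d) (sym (ℤP.pos-* a b))) (cong (λ z → + (a ℕ.* b) ℤ.* + suc z) (sym (ℕP.+-identityʳ d))))

  frac-mono-≤ : ∀ {a b d d'} → a ℕ.* suc d' ℕ.≤ b ℕ.* suc d → frac a (suc d) z<s ℚ.≤ frac b (suc d') z<s
  frac-mono-≤ {a} {b} {d} {d'} le = ℚP.toℚᵘ-cancel-≤
    (ℚᵘP.≤-respˡ-≃ (ℚᵘP.≃-sym (toℚᵘ-frac a d)) (ℚᵘP.≤-respʳ-≃ (ℚᵘP.≃-sym (toℚᵘ-frac b d'))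
      (*≤* (subst₂ ℤ._≤_ (ℤP.pos-* a (suc d')) (ℤP.pos-* b (suc d)) (ℤ.+≤+ le)))))

  frac-cancel-≤ : ∀ {a b d d'} → frac a (suc d) z<s ℚ.≤ frac b (suc d') z<s → a ℕ.* suc d' ℕ.≤ b ℕ.* suc d
  frac-cancel-≤ {a} {b} {d} {d'} le with subst₂ ℤ._≤_ (sym (ℤP.pos-* a (suc d'))) (sym (ℤP.pos-* b (suc d)))
    (ℚᵘP.drop-*≤* (ℚᵘP.≤-respˡ-≃ (toℚᵘ-frac a d) (ℚᵘP.≤-respʳ-≃ (toℚᵘ-frac b d') (ℚP.toℚᵘ-mono-≤ le))))
  ... | ℤ.+≤+ le′ = le′

  frac-cancel-≤₁ : ∀ {a b} → frac a 1 z<s ℚ.≤ frac b 1 z<s → a ℕ.≤ b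
  frac-cancel-≤₁ {a} {b} le = subst₂ ℕ._≤_ (ℕP.*-identityʳ a) (ℕP.*-identityʳ b) (frac-cancel-≤ {a} {b} {0} {0} le)

  frac-injective : ∀ {a b} → frac a 1 z<s ≡ frac b 1 z<s → a ≡ b
  frac-injective eq = ℕP.≤-antisym (frac-cancel-≤₁ (ℚP.≤-reflexive eq)) (frac-cancel-≤₁ (ℚP.≤-reflexive (sym eq)))

  frac-monoˡ-≤ : ∀ {a b d} → a ℕ.≤ b → frac a (suc d) z<s ℚ.≤ frac b (suc d) z<s
  frac-monoˡ-≤ {a} {b} {d} a≤b = frac-mono-≤ {a} {b} {d} {d} (ℕP.*-monoˡ-≤ (suc d) a≤b)

  frac-≤-1 : ∀ {a d} → a ℕ.≤ suc d → frac a (suc d) z<s ℚ.≤ 1ℚ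
  frac-≤-1 {a} {d} a≤ = frac-mono-≤ {a} {1} {d} {0} (subst₂ ℕ._≤_ (sym (ℕP.*-identityʳ a)) (sym (ℕP.*-identityˡ (suc d))) a≤)

  1-≤-frac : ∀ {a d} → suc d ℕ.≤ a → 1ℚ ℚ.≤ frac a (suc d) z<s
  1-≤-frac {a} {d} ≤a = frac-mono-≤ {1} {a} {0} {d} (subst₂ ℕ._≤_ (sym (ℕP.*-identityˡ (suc d))) (sym (ℕP.*-identityʳ a)) ≤a)

  sum-frac : ∀ {K} (f : Fin K → ℕ) d → ℚ∑.sum (λ i → frac (f i) (suc d) z<s) ≡ frac (sum f) (suc d) z<s
  sum-frac {zero} f d = sym (ℚP.0/n≡0 (suc d))
  sum-frac {suc K} f d = trans (cong (frac (f zero) (suc d) z<s ℚ.+_) (sum-frac (f ∘ suc) d)) (frac-+ (f zero) _ d)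

  numerator : ℚ → ℕ
  numerator q = ℤ.∣ ↥ q ∣

  numerator-scaling : ∀ q e → 0ℚ ℚ.≤ q → frac (e ℕ.* ↧ₙ q) 1 z<s ℚ.* q ≡ frac (numerator q ℕ.* e) 1 z<s
  numerator-scaling q@(mkℚ (+ k) d _) e _ = ≡-via-ℚᵘ
    (ℚᵘP.≃-trans (ℚP.toℚᵘ-homo-* (frac (e ℕ.* suc d) 1 z<s) q) (ℚᵘP.≃-trans (ℚᵘP.*-congʳ (toℚᵘ-frac (e ℕ.* suc d) 0)) cancel))
    (toℚᵘ-frac (k ℕ.* e) 0)
    where
    cancel : mkℚᵘ (+ (e ℕ.* suc d)) 0 ℚᵘ.* mkℚᵘ (+ k) d ≃ᵘ mkℚᵘ (+ (k ℕ.* e)) 0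
    cancel = *≡* (trans (cong (ℤ._* + 1) (sym (ℤP.pos-* (e ℕ.* suc d) k)))
                 (trans (sym (ℤP.pos-* (e ℕ.* suc d ℕ.* k) 1)) (trans (cong +_ (regroup e d k)) (ℤP.pos-* (k ℕ.* e) (suc (d ℕ.+ 0))))))
      where
      regroup : ∀ e d k → e ℕ.* suc d ℕ.* k ℕ.* 1 ≡ k ℕ.* e ℕ.* suc (d ℕ.+ 0)
      regroup = ℕ-Solver.solve-∀
  numerator-scaling (mkℚ -[1+ k ] d _) e q≥0 with ℚP.drop-*≤* q≥0
  ... | ()

  ∏ : ∀ {K} → (Fin K → ℕ) → ℕ
  ∏ {zero} f = 1
  ∏ {suc K} f = f zero ℕ.* ∏ (f ∘ suc)

  ∏-∣ : ∀ {K} (f : Fin K → ℕ) i → f i ∣ ∏ f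
  ∏-∣ {suc K} f zero = m∣m*n (∏ (f ∘ suc))
  ∏-∣ {suc K} f (suc i) = ∣-trans (∏-∣ (f ∘ suc) i) (n∣m*n (f zero))

  ∏-pos : ∀ {K} (f : Fin K → ℕ) → (∀ i → 0 ℕ.< f i) → 0 ℕ.< ∏ f
  ∏-pos {zero} f pos = z<s
  ∏-pos {suc K} f pos = ℕP.*-mono-≤ (pos zero) (∏-pos (f ∘ suc) (pos ∘ suc))

  clear-denominators : ∀ {N} (q : Fin N → Fin N → ℚ) → (∀ u v → 0ℚ ℚ.≤ q u v) →
                       ∃[ D ] 0 ℕ.< D × ∃[ A ] ∀ u v → frac (A u v) 1 z<s ≡ frac D 1 z<s ℚ.* q u v
  clear-denominators {N} q q≥0 = D , ∏-pos _ (λ u → ∏-pos (λ v → ↧ₙ q u v) (λ v → z<s)) , A , scaled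
    where
    D : ℕ
    D = ∏ (λ u → ∏ (λ v → ↧ₙ q u v))
    divides : ∀ u v → ↧ₙ q u v ∣ D
    divides u v = ∣-trans (∏-∣ (λ v → ↧ₙ q u v) v) (∏-∣ (λ u → ∏ (λ v → ↧ₙ q u v)) u)
    A : Fin N → Fin N → ℕ
    A u v = numerator (q u v) ℕ.* _∣_.quotient (divides u v)
    scaled : ∀ u v → frac (A u v) 1 z<s ≡ frac D 1 z<s ℚ.* q u v
    scaled u v = sym (trans (cong (λ d → frac d 1 z<s ℚ.* q u v) (_∣_.equality (divides u v)))
                            (numerator-scaling (q u v) (_∣_.quotient (divides u v)) (q≥0 u v)))

open Fractions

module FractionalFactors where

  open import Data.Nat as ℕ using (zero; suc; z<s)
  import Data.Nat.Properties as ℕP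
  open import Data.Nat.Tactic.RingSolver using (solve-∀)
  open import Data.Rational as ℚ using (ℚ; 0ℚ)
  import Data.Rational.Properties as ℚP
  open import Data.Bool using (true; false; if_then_else_)
  open import Data.Fin using (Fin; zero; suc)
  open import Data.List using (tabulate)
  import Data.List.Properties as List
  open import Data.Product using (_,_; proj₁; proj₂; ∃-syntax)
  open import Function using (id; _∘_)
  open import Relation.Binary.PropositionalEquality

  sumℚ-tabulate : ∀ {K} (f : Fin K → ℚ) → sumℚ (tabulate f) ≡ ℚ∑.sum f
  sumℚ-tabulate {zero} f = refl
  sumℚ-tabulate {suc K} f = cong (f zero ℚ.+_) (sumℚ-tabulate (f ∘ suc))

  module _ {N} (G : SimpleGraph N) where

    onEdges : Weight N → Weight N
    onEdges h u v = if adj G u v then h u v else 0ℚ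

    degree-∑ : ∀ h v → degree G h v ≡ ℚ∑.sum (onEdges h v)
    degree-∑ h v = trans (cong sumℚ (List.map-tabulate id (onEdges h v))) (sumℚ-tabulate (onEdges h v))

    onEdges-sym : ∀ {h} → IsEdgeFunction G h → ∀ u v → onEdges h u v ≡ onEdges h v u
    onEdges-sym {h} h-edge u v rewrite SimpleGraph.sym G v u with adj G u v in uv
    ... | true = h-edge u v uv
    ... | false = refl

    onEdges-range : ∀ {h} → (∀ u v → adj G u v ≡ true → (0ℚ ℚ.≤ h u v) × (h u v ℚ.≤ 1ℚ)) →
                    ∀ u v → (0ℚ ℚ.≤ onEdges h u v) × (onEdges h u v ℚ.≤ 1ℚ)
    onEdges-range {h} range u v with adj G u v in uv
    ... | true = range u v uv
    ... | false = ℚP.≤-refl , ℚP.<⇒≤ (ℚP.positive⁻¹ 1ℚ)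

    onEdges-loopless : ∀ h v → onEdges h v v ≡ 0ℚ
    onEdges-loopless h v rewrite SimpleGraph.irrefl G v = refl

    module Scaled {h : Weight N} {n m-1 : ℕ} (h-edge : IsEdgeFunction G h)
                  (h-range : ∀ u v → adj G u v ≡ true → (0ℚ ℚ.≤ h u v) × (h u v ℚ.≤ 1ℚ))
                  (h-degree : ∀ v → (1ℚ ℚ.≤ degree G h v) × (degree G h v ℚ.≤ frac n (suc m-1) z<s))
                  (D : ℕ) (A : Matrix N) (scaled : ∀ u v → frac (A u v) 1 z<s ≡ frac (D ℕ.* suc m-1) 1 z<s ℚ.* onEdges h u v) where

      private
        s : ℕ
        s = D ℕ.* suc m-1
        s′ : ℚ
        s′ = frac s 1 z<s
        instance
          s′-nonNeg : ℚ.NonNegative s′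
          s′-nonNeg = ℚP.normalize-nonNeg s 1

      frac-deg : ∀ v → frac (deg A v) 1 z<s ≡ s′ ℚ.* degree G h v
      frac-deg v = begin
        frac (sum (A v)) 1 z<s                    ≡⟨ sum-frac (A v) 0 ⟨
        ℚ∑.sum (λ u → frac (A v u) 1 z<s)         ≡⟨ ℚ∑.sum-cong-≗ (scaled v) ⟩
        ℚ∑.sum (λ u → s′ ℚ.* onEdges h v u)       ≡⟨ ℚ∑.*-distribˡ-sum s′ (onEdges h v) ⟨
        s′ ℚ.* ℚ∑.sum (onEdges h v)               ≡⟨ cong (s′ ℚ.*_) (degree-∑ h v) ⟨
        s′ ℚ.* degree G h v                       ∎
        where open ≡-Reasoning

      lower : ∀ v → s ℕ.≤ deg A v
      lower v = frac-cancel-≤₁ (begin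
        s′                      ≡⟨ ℚP.*-identityʳ s′ ⟨
        s′ ℚ.* 1ℚ               ≤⟨ ℚP.*-monoˡ-≤-nonNeg s′ (proj₁ (h-degree v)) ⟩
        s′ ℚ.* degree G h v     ≡⟨ frac-deg v ⟨
        frac (deg A v) 1 z<s    ∎)
        where open ℚP.≤-Reasoning

      upper : ∀ v → deg A v ℕ.≤ D ℕ.* n
      upper v = ℕP.*-cancelʳ-≤ (deg A v) (D ℕ.* n) (suc m-1)
        (subst (deg A v ℕ.* suc m-1 ℕ.≤_) (regroup D m-1 n) (frac-cancel-≤ {deg A v} {s ℕ.* n} {0} {m-1} scaled-upper))
        where
        regroup : ∀ D m-1 n → D ℕ.* suc m-1 ℕ.* n ℕ.* 1 ≡ D ℕ.* n ℕ.* suc m-1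
        regroup = solve-∀
        scaled-upper : frac (deg A v) 1 z<s ℚ.≤ frac (s ℕ.* n) (suc m-1) z<s
        scaled-upper = begin
          frac (deg A v) 1 z<s              ≡⟨ frac-deg v ⟩
          s′ ℚ.* degree G h v               ≤⟨ ℚP.*-monoˡ-≤-nonNeg s′ (proj₂ (h-degree v)) ⟩
          s′ ℚ.* frac n (suc m-1) z<s       ≡⟨ frac-* s n m-1 ⟩
          frac (s ℕ.* n) (suc m-1) z<s      ∎
          where open ℚP.≤-Reasoning

      vanishes : ∀ {u v} → onEdges h u v ≡ 0ℚ → A u v ≡ 0
      vanishes {u} {v} h≡0 = frac-injective (begin
        frac (A u v) 1 z<s        ≡⟨ scaled u v ⟩
        s′ ℚ.* onEdges h u v      ≡⟨ cong (s′ ℚ.*_) h≡0 ⟩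
        s′ ℚ.* 0ℚ                 ≡⟨ ℚP.*-zeroʳ s′ ⟩
        0ℚ                        ≡⟨ ℚP.0/n≡0 1 ⟨
        frac 0 1 z<s              ∎)
        where open ≡-Reasoning

      bounded : Bounded s (λ _ → s) (λ _ → D ℕ.* n) A
      bounded = record
        { symmetric = λ u v → frac-injective (trans (scaled u v) (trans (cong (s′ ℚ.*_) (onEdges-sym h-edge u v)) (sym (scaled v u))))
        ; loopless  = λ v → vanishes (onEdges-loopless h v)
        ; capped    = λ u v → frac-cancel-≤₁ (begin
            frac (A u v) 1 z<s       ≡⟨ scaled u v ⟩
            s′ ℚ.* onEdges h u v     ≤⟨ ℚP.*-monoˡ-≤-nonNeg s′ (proj₂ (onEdges-range h-range u v)) ⟩
            s′ ℚ.* 1ℚ                ≡⟨ ℚP.*-identityʳ s′ ⟩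
            s′                       ∎)
        ; lower     = lower
        ; upper     = upper
        }
        where open ℚP.≤-Reasoning

      support : ∀ u v → adj G u v ≡ false → A u v ≡ 0
      support u v non-edge = vanishes (cong (λ b → if b then h u v else 0ℚ) non-edge)

    module Rescaled {n m-1 : ℕ} (x : Matrix N) (x-bounded : Bounded (suc m-1) (λ _ → suc m-1) (λ _ → n) x)
                    (x-support : ∀ u v → adj G u v ≡ false → x u v ≡ 0) where

      open Bounded x-bounded

      W : Weight N
      W u v = frac (x u v) (suc m-1) z<s

      degree-W : ∀ v → degree G W v ≡ frac (deg x v) (suc m-1) z<s
      degree-W v = trans (degree-∑ W v) (trans (ℚ∑.sum-cong-≗ on-edges) (sum-frac (x v) m-1))
        where
        on-edges : ∀ u → onEdges W v u ≡ W v u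
        on-edges u with adj G v u in vu
        ... | true = refl
        ... | false = trans (sym (ℚP.0/n≡0 (suc m-1))) (cong (λ k → frac k (suc m-1) z<s) (sym (x-support v u vu)))

      W-range : ∀ u v → (0ℚ ℚ.≤ W u v) × (W u v ℚ.≤ 1ℚ)
      W-range u v = ℚP.nonNegative⁻¹ (W u v) {{ℚP.normalize-nonNeg (x u v) (suc m-1)}} , frac-≤-1 (capped u v)

      degree-range : ∀ v → (1ℚ ℚ.≤ degree G W v) × (degree G W v ℚ.≤ frac n (suc m-1) z<s)
      degree-range v rewrite degree-W v = 1-≤-frac (lower v) , frac-monoˡ-≤ (upper v)

      factor : IsFractionalFactor G 1ℚ (frac n (suc m-1) z<s) W
      factor = (λ u v _ → cong (λ k → frac k (suc m-1) z<s) (symmetric u v)) , (λ u v _ → W-range u v) , degree-range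

      values : ValuesIn1/m G (suc m-1) z<s W
      values u v _ = x u v , capped u v , refl

    integral-scaling : ∀ {h n m-1} → IsFractionalFactor G 1ℚ (frac n (suc m-1) z<s) h →
                       ∃[ D ] 0 < D × ∃[ A ] Bounded (D ℕ.* suc m-1) (λ _ → D ℕ.* suc m-1) (λ _ → D ℕ.* n) A
                                            × (∀ u v → adj G u v ≡ false → A u v ≡ 0)
    integral-scaling {h} {n} {m-1} (h-edge , h-range , h-degree) =
      let D , 0<D , A , A-scaled = clear-denominators (λ u v → m′ ℚ.* onEdges h u v) nonNeg
          open Scaled {h} {n} {m-1} h-edge h-range h-degree D A (λ u v → trans (A-scaled u v) (regroup D (onEdges h u v)))
      in D , 0<D , A , bounded , support
      where
      m′ : ℚ
      m′ = frac (suc m-1) 1 z<s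
      regroup : ∀ D q → frac D 1 z<s ℚ.* (m′ ℚ.* q) ≡ frac (D ℕ.* suc m-1) 1 z<s ℚ.* q
      regroup D q = trans (sym (ℚP.*-assoc (frac D 1 z<s) m′ q)) (cong (ℚ._* q) (frac-* D (suc m-1) 0))
      nonNeg : ∀ u v → 0ℚ ℚ.≤ m′ ℚ.* onEdges h u v
      nonNeg u v = ℚP.nonNegative⁻¹ _ {{ℚP.nonNeg*nonNeg⇒nonNeg m′ {{ℚP.normalize-nonNeg (suc m-1) 1}} (onEdges h u v)
                                            {{ℚ.nonNegative (proj₁ (onEdges-range h-range u v))}}}}

open FractionalFactors

corollary2p5 : ∀ {N} (G : SimpleGraph N) (n m : ℕ) (0<m : 0 < m) → m < n
    → (∃ λ h → IsFractionalFactor G 1ℚ (frac n m 0<m) h)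
    → ∃ λ h → IsFractionalFactor G 1ℚ (frac n m 0<m) h × ValuesIn1/m G m 0<m h
corollary2p5 G n (suc m-1) z<s m<n (h , h-factor) =
  let D , 0<D , A , A-bounded , A-support = integral-scaling G {h} {n} {m-1} h-factor
      x , x-bounded , x-support = integral-factor D {{>-nonZero 0<D}} (suc m-1) (λ _ → suc m-1) (λ _ → n) (λ _ → m<n) A A-bounded
      open Rescaled G x x-bounded (λ u v non-edge → x-support u v (A-support u v non-edge))
  in W , factor , values
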